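{- Let $G$ be a $2$-connected $[4,2]$-graph of order $n\ge 10$. Then $e(G)\ge \lfloor (n-1)^2/4\rfloor+2$, with equality if and only if $G$ is isomorphic to $B_n^+$.
   Context: All graphs are finite and simple. $e(G)$ denotes the number of edges of $G$. For a positive integer $s$ and a nonnegative integer $t$, a graph $G$ of order at least $s$ is called an $[s,t]$-graph if every induced subgraph of $G$ on $s$ vertices has at least $t$ edges. $B_n^+$ denotes the $2$-connected graph of order $n$ obtained from the vertex-disjoint union of complete graphs $K_{\lfloor n/2\rfloor}$ and $K_{\lceil n/2\rceil}$ by adding two edges (necessarily two vertex-disjoint edges each joining the two cliques). -}

module Defs where

open import Data.Nat using (ℕ; zero; suc; _+_; _*_; _∸_; _≤_; _<ᵇ_; _≡ᵇ_)
open import Data.Nat.DivMod using (_/_)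
open import Data.Bool using (Bool; true; false; _∧_; _∨_; not; if_then_else_)
open import Data.Bool.Properties using (∨-comm; ∨-assoc)
open import Data.Fin using (Fin; toℕ)
open import Data.List using (List; map; allFin)
open import Data.Nat.ListAction using (sum)
open import Data.Product using (_×_; Σ)
open import Data.Unit using (⊤)
open import Relation.Binary.PropositionalEquality using (_≡_; _≢_; refl; cong; cong₂)
open import Function.Bundles using (_↔_; Inverse)

record Graph (n : ℕ) : Set where
  field
    adj    : Fin n → Fin n → Bool
    sym    : ∀ i j → adj i j ≡ adj j i
    irrefl : ∀ i → adj i i ≡ false
open Graph public

e : ∀ {n} → Graph n → ℕ
e {n} G = sum (map (λ i → sum (map (λ j →
            if adj G i j ∧ (toℕ i <ᵇ toℕ j) then 1 else 0) (allFin n))) (allFin n))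

b2n : Bool → ℕ
b2n true  = 1
b2n false = 0

edges4 : ∀ {n} → Graph n → Fin n → Fin n → Fin n → Fin n → ℕ
edges4 G a b c d = b2n (adj G a b) + b2n (adj G a c) + b2n (adj G a d)
                 + b2n (adj G b c) + b2n (adj G b d) + b2n (adj G c d)

Is4-2 : ∀ {n} → Graph n → Set
Is4-2 {n} G = 4 ≤ n × (∀ a b c d → a ≢ b → a ≢ c → a ≢ d → b ≢ c → b ≢ d → c ≢ d
                         → 2 ≤ edges4 G a b c d)

data Reach {n} (G : Graph n) (P : Fin n → Set) : Fin n → Fin n → Set where
  here : ∀ {u} → P u → Reach G P u u
  step : ∀ {u w v} → P u → adj G u w ≡ true → Reach G P w v → Reach G P u v

TwoConnected : ∀ {n} → Graph n → Set
TwoConnected {n} G =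
  3 ≤ n
  × (∀ u v → Reach G (λ _ → ⊤) u v)
  × (∀ w u v → u ≢ w → v ≢ w → Reach G (λ x → x ≢ w) u v)

_≅_ : ∀ {n} → Graph n → Graph n → Set
_≅_ {n} G H = Σ (Fin n ↔ Fin n) λ f →
  ∀ i j → adj G (Inverse.to f i) (Inverse.to f j) ≡ adj H i j

-- B_n^+ : cliques on {0,…,h-1} and {h,…,n-1} with h = ⌊n/2⌋, plus the two
-- vertex-disjoint edges 0–h and 1–(h+1).
sameB : Bool → Bool → Bool
sameB true  true  = true
sameB false false = true
sameB _     _     = false

cross : ℕ → ℕ → ℕ → Bool
cross h a b = ((a ≡ᵇ 0) ∧ (b ≡ᵇ h)) ∨ ((a ≡ᵇ 1) ∧ (b ≡ᵇ suc h))

badj : ℕ → ℕ → ℕ → Bool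
badj h a b = not (a ≡ᵇ b) ∧ (sameB (a <ᵇ h) (b <ᵇ h) ∨ (cross h a b ∨ cross h b a))

private
  ≡ᵇ-sym : ∀ a b → (a ≡ᵇ b) ≡ (b ≡ᵇ a)
  ≡ᵇ-sym zero zero = refl
  ≡ᵇ-sym zero (suc b) = refl
  ≡ᵇ-sym (suc a) zero = refl
  ≡ᵇ-sym (suc a) (suc b) = ≡ᵇ-sym a b

  ≡ᵇ-refl : ∀ a → (a ≡ᵇ a) ≡ true
  ≡ᵇ-refl zero = refl
  ≡ᵇ-refl (suc a) = ≡ᵇ-refl a

  sameB-sym : ∀ x y → sameB x y ≡ sameB y x
  sameB-sym true true = refl
  sameB-sym true false = refl
  sameB-sym false true = refl
  sameB-sym false false = refl

  badj-sym : ∀ h a b → badj h a b ≡ badj h b a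
  badj-sym h a b = cong₂ (λ x y → not x ∧ y) (≡ᵇ-sym a b)
    (cong₂ _∨_ (sameB-sym (a <ᵇ h) (b <ᵇ h)) (∨-comm (cross h a b) (cross h b a)))

  badj-irr : ∀ h a → badj h a a ≡ false
  badj-irr h a rewrite ≡ᵇ-refl a = refl

B+ : (n : ℕ) → Graph n
B+ n = record
  { adj    = λ i j → badj (n / 2) (toℕ i) (toℕ j)
  ; sym    = λ i j → badj-sym (n / 2) (toℕ i) (toℕ j)
  ; irrefl = λ i → badj-irr (n / 2) (toℕ i)
  }

bound : ℕ → ℕ
bound n = (n ∸ 1) * (n ∸ 1) / 4 + 2

{-# OPTIONS --safe #-}
module Submission where

-- Work in the complement H of G. The [4,2] condition says that a vertex outside a triangle of H
-- is adjacent to at most one of its corners, and e(G) + e(H) = ⌊(n-1)²/4⌋ + ⌊n²/4⌋, so the claim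
-- becomes e(H) ≤ ⌊n²/4⌋ - 2, with equality only when G ≅ B_n^+.
-- If H has a triangle, deleting it and bounding the rest by Mantel's theorem (which survives the
-- [4,2] condition up to a lone triangle) gives e(H) ≤ ⌊n²/4⌋ - 3.
-- Otherwise let v have maximum H-degree Δ, N its H-neighbourhood (a clique of G, as H is
-- triangle-free) and W the other w = n - Δ vertices. Then e(H) = e_H(W,N) + e(H[W]) with
-- e_H(W,N) = Δw - e_G(W,N), and maximality of Δ gives 2e(H[W]) ≤ e_G(W,N). An edge of H[W] has no
-- common H-neighbour in N, which costs Δ more and again gives the strict bound. Otherwise W is a
-- clique of G too, 2-connectivity provides two disjoint G-edges between N and W, and
-- e(H) ≤ Δw - 2 ≤ ⌊n²/4⌋ - 2; equality forces exactly these two crossing edges and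
-- {Δ, w} = {⌊n/2⌋, ⌈n/2⌉}, which is B_n^+ up to relabelling.

open import Defs renaming (sym to adj-sym; irrefl to adj-irrefl)
open import Data.Nat using (ℕ; zero; suc; _+_; _*_; _∸_; _≤_; _<_; _<ᵇ_; _≡ᵇ_; z≤n; s≤s; NonZero; _<?_; _≤?_)
open import Data.Nat.Properties
open import Data.Nat.DivMod
  using (_/_; _%_; /-monoˡ-≤; m≡m%n+[m/n]*n; m%n<n; +-distrib-/; m<n⇒m/n≡0; m*n/n≡m; m<n⇒m%n≡m; m*n%n≡0)
open import Data.Nat.Induction using (<-wellFounded)
open import Data.Nat.Tactic.RingSolver using (solve-∀)
import Data.Nat.ListAction as List
open import Data.Bool using (Bool; true; false; _∧_; _∨_; not; if_then_else_; T)
open import Data.Bool.Properties using (∧-zeroʳ; ∨-zeroʳ; ∨-identityʳ; not-injective)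
import Data.Bool.Properties as Boolₚ
open import Data.Fin using (Fin; zero; suc; toℕ; fromℕ<; punchOut)
import Data.Fin.Properties as Finₚ
open import Data.List using (map; allFin; tabulate)
open import Data.Product using (∃; ∃₂; _×_; _,_; proj₁; proj₂)
open import Data.Sum using (_⊎_; inj₁; inj₂)
open import Data.Unit using (tt)
open import Data.Empty using (⊥; ⊥-elim)
open import Function using (id; _∘_; case_of_)
open import Function.Bundles using (_↔_; Inverse; mk↔ₛ′; _⇔_; mk⇔)
open import Induction.WellFounded using (Acc; acc)
open import Relation.Binary using (tri<; tri≈; tri>)
open import Relation.Binary.PropositionalEquality
open import Relation.Nullary using (¬_; Dec; does; yes; no)
open import Relation.Nullary.Decidable using (dec-true; dec-false; map′; _×-dec_)
open import Algebra.Properties.CommutativeMonoid.Sum +-0-commutativeMonoid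
  using (sum; sum-cong-≗; ∑-distrib-+; ∑-comm; sum-permute; sum-replicate-zero)
open import Algebra.Properties.CommutativeSemigroup +-commutativeSemigroup
  using () renaming (x∙yz≈y∙xz to x+[y+z]≡y+[x+z])
open import Algebra.Properties.CommutativeSemigroup *-commutativeSemigroup
  using () renaming (x∙yz≈y∙xz to x*[y*z]≡y*[x*z])
open import Algebra.Properties.Semiring.Sum +-*-semiring using (*-distribˡ-sum)

infix 4 _==_

_==_ : ∀ {n} → Fin n → Fin n → Bool
x == y = does (x Finₚ.≟ y)

==-refl : ∀ {n} (x : Fin n) → (x == x) ≡ true
==-refl x = dec-true (x Finₚ.≟ x) refl

==-≢ : ∀ {n} {x y : Fin n} → x ≢ y → (x == y) ≡ false
==-≢ {x = x} {y} = dec-false (x Finₚ.≟ y)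

==⇒≡ : ∀ {n} {x y : Fin n} → (x == y) ≡ true → x ≡ y
==⇒≡ {x = x} {y} x==y with x Finₚ.≟ y | x==y
... | yes x≡y | _ = x≡y

==-false⇒≢ : ∀ {n} {x y : Fin n} → (x == y) ≡ false → x ≢ y
==-false⇒≢ {x = x} x==y refl with () ← trans (sym x==y) (==-refl x)

==-sym : ∀ {n} (x y : Fin n) → (x == y) ≡ (y == x)
==-sym x y with x Finₚ.≟ y
... | yes refl = sym (==-refl x)
... | no x≢y = sym (==-≢ (λ y≡x → x≢y (sym y≡x)))

<ᵇ-true : ∀ {a b} → a < b → (a <ᵇ b) ≡ true
<ᵇ-true {a} {b} = dec-true (a <? b)

<ᵇ-false : ∀ {a b} → b ≤ a → (a <ᵇ b) ≡ false
<ᵇ-false {a} {b} b≤a = dec-false (a <? b) (≤⇒≯ b≤a)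

<ᵇ-true⇒< : ∀ {a b} → (a <ᵇ b) ≡ true → a < b
<ᵇ-true⇒< {a} {b} a<ᵇb = <ᵇ⇒< a b (subst T (sym a<ᵇb) tt)

≡ᵇ-true : ∀ {a b} → a ≡ b → (a ≡ᵇ b) ≡ true
≡ᵇ-true {a} {b} = dec-true (a ≟ b)

≡ᵇ-false : ∀ {a b} → a ≢ b → (a ≡ᵇ b) ≡ false
≡ᵇ-false {a} {b} = dec-false (a ≟ b)

≡ᵇ-true⇒≡ : ∀ {a b} → (a ≡ᵇ b) ≡ true → a ≡ b
≡ᵇ-true⇒≡ {a} {b} a≡ᵇb = ≡ᵇ⇒≡ a b (subst T (sym a≡ᵇb) tt)

<ᵇ-false⇒≥ : ∀ {a b} → (a <ᵇ b) ≡ false → b ≤ a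
<ᵇ-false⇒≥ a≮ᵇb = ≮⇒≥ (λ a<b → case trans (sym (<ᵇ-true a<b)) a≮ᵇb of λ ())

zeroAt : ∀ {n} → Fin n → (Fin n → ℕ) → Fin n → ℕ
zeroAt x f i = if i == x then 0 else f i

zeroAt-≢ : ∀ {n} {x y : Fin n} (f : Fin n → ℕ) → y ≢ x → zeroAt x f y ≡ f y
zeroAt-≢ {x = x} {y} f y≢x rewrite ==-≢ y≢x = refl

-- Opaque, so that a constraint ∑ f ≡ ∑ g can be solved by unifying f with g.
opaque
  ∑ : ∀ {n} → (Fin n → ℕ) → ℕ
  ∑ = sum

  ∑-cong : ∀ {n} {f g : Fin n → ℕ} → (∀ i → f i ≡ g i) → ∑ f ≡ ∑ g
  ∑-cong = sum-cong-≗

  ∑-+ : ∀ {n} (f g : Fin n → ℕ) → ∑ (λ i → f i + g i) ≡ ∑ f + ∑ g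
  ∑-+ = ∑-distrib-+

  ∑-swap : ∀ {m n} (f : Fin m → Fin n → ℕ) → ∑ (λ i → ∑ (f i)) ≡ ∑ (λ j → ∑ (λ i → f i j))
  ∑-swap = ∑-comm

  ∑-*ˡ : ∀ {n} c (f : Fin n → ℕ) → ∑ (λ i → c * f i) ≡ c * ∑ f
  ∑-*ˡ c f = sym (*-distribˡ-sum c f)

  ∑-permute : ∀ {n} (f : Fin n → ℕ) (σ : Fin n ↔ Fin n) → ∑ (λ i → f (Inverse.to σ i)) ≡ ∑ f
  ∑-permute f σ = sym (sum-permute f σ)

  ∑-suc : ∀ {n} (f : Fin (suc n) → ℕ) → ∑ f ≡ f zero + ∑ (λ i → f (suc i))
  ∑-suc f = refl

  ∑-zero : ∀ n → ∑ {n} (λ _ → 0) ≡ 0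
  ∑-zero = sum-replicate-zero

  ∑-mono-≤ : ∀ {n} {f g : Fin n → ℕ} → (∀ i → f i ≤ g i) → ∑ f ≤ ∑ g
  ∑-mono-≤ {zero}  f≤g = z≤n
  ∑-mono-≤ {suc n} f≤g = +-mono-≤ (f≤g zero) (∑-mono-≤ (λ i → f≤g (suc i)))

  ∑-const : ∀ n c → ∑ {n} (λ _ → c) ≡ n * c
  ∑-const zero    c = refl
  ∑-const (suc n) c = cong (c +_) (∑-const n c)

  ∑-indicator : ∀ {n} (x : Fin n) (f : Fin n → ℕ) → ∑ (λ i → b2n (i == x) * f i) ≡ f x
  ∑-indicator {suc n} zero f =
    trans (cong₂ _+_ (+-identityʳ (f zero)) (∑-zero n)) (+-identityʳ (f zero))
  ∑-indicator {suc n} (suc x) f = ∑-indicator x (λ i → f (suc i))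

  ∑-zeroAt : ∀ {n} (x : Fin n) (f : Fin n → ℕ) → ∑ f ≡ f x + ∑ (zeroAt x f)
  ∑-zeroAt zero    f = refl
  ∑-zeroAt (suc x) f = trans (cong (f zero +_) (∑-zeroAt x (λ i → f (suc i))))
                             (x+[y+z]≡y+[x+z] (f zero) (f (suc x)) _)

  ∑-positive : ∀ {n} (f : Fin n → ℕ) → 0 < ∑ f → ∃ λ i → 0 < f i
  ∑-positive {suc n} f 0<∑ with f zero in f0
  ... | suc _ = zero , subst (0 <_) (sym f0) (s≤s z≤n)
  ... | zero with ∑-positive (λ i → f (suc i)) 0<∑
  ...   | i , 0<fi = suc i , 0<fi

  ∑-allFin : ∀ {n} (f : Fin n → ℕ) → List.sum (map f (allFin n)) ≡ ∑ f
  ∑-allFin f = go f id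
    where
    go : ∀ {m} {B : Set} (f : B → ℕ) (g : Fin m → B) → List.sum (map f (tabulate g)) ≡ ∑ (λ i → f (g i))
    go {zero}  f g = refl
    go {suc m} f g = cong (f (g zero) +_) (go f (λ i → g (suc i)))

∑-≥-plus : ∀ {n} (f : Fin n → ℕ) x {k} → k ≤ ∑ (zeroAt x f) → f x + k ≤ ∑ f
∑-≥-plus f x k≤ = ≤-trans (+-monoʳ-≤ (f x) k≤) (≤-reflexive (sym (∑-zeroAt x f)))

∑-≥-term : ∀ {n} (f : Fin n → ℕ) x → f x ≤ ∑ f
∑-≥-term f x = ≤-trans (m≤m+n (f x) _) (≤-reflexive (sym (∑-zeroAt x f)))

∑-≥-pair : ∀ {n} (f : Fin n → ℕ) {x y} → x ≢ y → f x + f y ≤ ∑ f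
∑-≥-pair f {x} {y} x≢y =
  ∑-≥-plus f x (subst (_≤ ∑ (zeroAt x f)) (zeroAt-≢ f (≢-sym x≢y)) (∑-≥-term (zeroAt x f) y))

∑-≥-triple : ∀ {n} (f : Fin n → ℕ) {x y z} → x ≢ y → x ≢ z → y ≢ z → f x + f y + f z ≤ ∑ f
∑-≥-triple f {x} {y} {z} x≢y x≢z y≢z = subst (_≤ ∑ f) (sym (+-assoc (f x) (f y) (f z)))
  (∑-≥-plus f x (subst (_≤ ∑ (zeroAt x f)) (cong₂ _+_ (zeroAt-≢ f (≢-sym x≢y)) (zeroAt-≢ f (≢-sym x≢z)))
                                (∑-≥-pair (zeroAt x f) y≢z)))

argmax : ∀ {n} → Fin n → (f : Fin n → ℕ) → ∃ λ v → ∀ u → f u ≤ f v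
argmax {suc zero}    zero f = zero , λ { zero → ≤-refl }
argmax {suc (suc n)} _    f with argmax zero (λ i → f (suc i))
... | v , maximal with f zero ≤? f (suc v)
...   | yes f0≤fv = suc v , λ { zero → f0≤fv ; (suc u) → maximal u }
...   | no  f0≰fv = zero , λ { zero → ≤-refl ; (suc u) → ≤-trans (maximal u) (<⇒≤ (≰⇒> f0≰fv)) }

VSet : ℕ → Set
VSet n = Fin n → Bool

full : ∀ {n} → VSet n
full _ = true

⁅_⁆ : ∀ {n} → Fin n → VSet n
⁅ x ⁆ w = w == x

infixl 6 _─_

_─_ : ∀ {n} → VSet n → Fin n → VSet n
(S ─ x) w = S w ∧ not (w == x)

size : ∀ {n} → VSet n → ℕ
size S = ∑ λ u → b2n (S u)

infix 4 _≐_⊍_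

_≐_⊍_ : ∀ {n} → VSet n → VSet n → VSet n → Set
S ≐ A ⊍ B = ∀ w → b2n (S w) ≡ b2n (A w) + b2n (B w)

b2n≤1 : ∀ b → b2n b ≤ 1
b2n≤1 true  = ≤-refl
b2n≤1 false = z≤n

∈-─⁻ : ∀ {n} {S : VSet n} {x w} → (S ─ x) w ≡ true → S w ≡ true × w ≢ x
∈-─⁻ {S = S} {x} {w} w∈ with S w | w == x in w==x
... | true | false = refl , ==-false⇒≢ w==x

∈-─⁺ : ∀ {n} {S : VSet n} {x w} → S w ≡ true → w ≢ x → (S ─ x) w ≡ true
∈-─⁺ w∈S w≢x rewrite w∈S | ==-≢ w≢x = refl

─-⊍-⁅⁆ : ∀ {n} {S : VSet n} {x} → S x ≡ true → S ≐ (S ─ x) ⊍ ⁅ x ⁆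
─-⊍-⁅⁆ {S = S} {x} x∈S w with w == x in w==x
... | true with refl ← ==⇒≡ {x = w} {x} w==x rewrite x∈S = refl
... | false with S w
...   | true  = refl
...   | false = refl

size-⊍ : ∀ {n} {S A B : VSet n} → S ≐ A ⊍ B → size S ≡ size A + size B
size-⊍ S≐A⊍B = trans (∑-cong S≐A⊍B) (∑-+ _ _)

size-⁅⁆ : ∀ {n} (x : Fin n) → size ⁅ x ⁆ ≡ 1
size-⁅⁆ x = trans (∑-cong (λ i → sym (*-identityʳ _))) (∑-indicator x (λ _ → 1))

size-─ : ∀ {n} {S : VSet n} {x} → S x ≡ true → size S ≡ suc (size (S ─ x))
size-─ {S = S} {x} x∈S =
  trans (size-⊍ (─-⊍-⁅⁆ x∈S)) (trans (cong (size (S ─ x) +_) (size-⁅⁆ x)) (+-comm (size (S ─ x)) 1))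

size-─-≤ : ∀ {n} (S : VSet n) x → size S ≤ size (S ─ x) + 1
size-─-≤ S x = ≤-trans (∑-mono-≤ pointwise)
                       (≤-reflexive (trans (∑-+ _ _) (cong (size (S ─ x) +_) (size-⁅⁆ x))))
  where
  pointwise : ∀ w → b2n (S w) ≤ b2n ((S ─ x) w) + b2n (⁅ x ⁆ w)
  pointwise w with w == x
  ... | true  = ≤-trans (b2n≤1 (S w)) (m≤n+m 1 _)
  ... | false with S w
  ...   | true  = ≤-refl
  ...   | false = z≤n

size-full : ∀ n → size (full {n}) ≡ n
size-full n = trans (∑-const n 1) (*-identityʳ n)

∃-∈ : ∀ {n} (S : VSet n) → 1 ≤ size S → ∃ λ u → S u ≡ true
∃-∈ S 1≤size with ∑-positive (λ u → b2n (S u)) 1≤size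
... | u , 0<Su with S u in u∈S
...   | true = u , u∈S

∃-∈-≢ : ∀ {n} (S : VSet n) → 2 ≤ size S → ∀ a → ∃ λ u → S u ≡ true × u ≢ a
∃-∈-≢ S 2≤size a with ∃-∈ (S ─ a) (≤-pred (≤-trans 2≤size (≤-trans (size-─-≤ S a) (≤-reflexive (+-comm _ 1)))))
... | u , u∈S─a = u , ∈-─⁻ {S = S} u∈S─a

∑-in-≤-size : ∀ {n} (S : VSet n) (c : Fin n → ℕ) → (∀ w → S w ≡ true → c w ≤ 1) →
              ∑ (λ w → b2n (S w) * c w) ≤ size S
∑-in-≤-size S c c≤1 = ∑-mono-≤ pointwise
  where
  pointwise : ∀ w → b2n (S w) * c w ≤ b2n (S w)
  pointwise w with S w in w∈S
  ... | true  = ≤-trans (≤-reflexive (+-identityʳ (c w))) (c≤1 w w∈S)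
  ... | false = z≤n

size-─-─ : ∀ {n} {S : VSet n} {x y} → S x ≡ true → S y ≡ true → y ≢ x → size S ≡ 2 + size (S ─ x ─ y)
size-─-─ {S = S} x∈S y∈S y≢x = trans (size-─ x∈S) (cong suc (size-─ (∈-─⁺ {S = S} y∈S y≢x)))

size-─-─-─ : ∀ {n} {S : VSet n} {x y z} → S x ≡ true → S y ≡ true → S z ≡ true → y ≢ x → z ≢ x → z ≢ y →
             size S ≡ 3 + size (S ─ x ─ y ─ z)
size-─-─-─ {S = S} x∈S y∈S z∈S y≢x z≢x z≢y =
  trans (size-─-─ x∈S y∈S y≢x) (cong (2 +_) (size-─ (∈-─⁺ {S = S ─ _} (∈-─⁺ {S = S} z∈S z≢x) z≢y)))

∁ : ∀ {n} → VSet n → VSet n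
∁ S u = not (S u)

full≐S⊍∁S : ∀ {n} (S : VSet n) → full ≐ S ⊍ ∁ S
full≐S⊍∁S S u with S u
... | true  = refl
... | false = refl

size-S+size-∁S : ∀ {n} (S : VSet n) → size S + size (∁ S) ≡ n
size-S+size-∁S {n} S = trans (sym (size-⊍ (full≐S⊍∁S S))) (size-full n)

∁⇒∉ : ∀ {n} {S : VSet n} {u} → ∁ S u ≡ true → S u ≡ false
∁⇒∉ {S = S} {u} u∈∁S with S u
... | false = refl

∉⇒∁ : ∀ {n} {S : VSet n} {u} → S u ≡ false → ∁ S u ≡ true
∉⇒∁ u∉S rewrite u∉S = refl

∉≢∈ : ∀ {n} {S : VSet n} {u v} → S u ≡ false → S v ≡ true → u ≢ v
∉≢∈ u∉S v∈S refl with () ← trans (sym u∉S) v∈S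

∁∉⇒∈ : ∀ {n} {S : VSet n} {u} → ∁ S u ≡ false → S u ≡ true
∁∉⇒∈ {S = S} {u} u∉∁S with S u
... | true = refl

infix 4 _⊆_

_⊆_ : ∀ {n} → VSet n → VSet n → Set
S ⊆ T = ∀ {w} → S w ≡ true → T w ≡ true

size-mono-⊆ : ∀ {n} {S T : VSet n} → S ⊆ T → size S ≤ size T
size-mono-⊆ {S = S} {T} S⊆T = ∑-mono-≤ pointwise
  where
  pointwise : ∀ w → b2n (S w) ≤ b2n (T w)
  pointwise w with S w in w∈S
  ... | false = z≤n
  ... | true rewrite S⊆T w∈S = ≤-refl

size-mono-⊂ : ∀ {n} {S T : VSet n} {x} → S ⊆ T → S x ≡ false → T x ≡ true → size S < size T
size-mono-⊂ {S = S} {T} {x} S⊆T x∉S x∈T = begin-strict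
  size S                   <⟨ n<1+n (size S) ⟩
  suc (size S)             ≡⟨ +-comm 1 (size S) ⟩
  size S + 1               ≡⟨ cong (size S +_) (sym (size-⁅⁆ x)) ⟩
  size S + size ⁅ x ⁆      ≡⟨ sym (∑-+ _ _) ⟩
  ∑ (λ w → b2n (S w) + b2n (w == x)) ≤⟨ ∑-mono-≤ pointwise ⟩
  size T                   ∎
  where
  open ≤-Reasoning
  pointwise : ∀ w → b2n (S w) + b2n (w == x) ≤ b2n (T w)
  pointwise w with w == x in w==x
  ... | true with refl ← ==⇒≡ {x = w} {x} w==x rewrite x∉S | x∈T = ≤-refl
  ... | false with S w in w∈S
  ...   | false = z≤n
  ...   | true rewrite S⊆T w∈S = ≤-refl

size-below : ∀ {n} k → k ≤ n → size {n} (λ i → toℕ i <ᵇ k) ≡ k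
size-below {n}     zero    _         = ∑-zero n
size-below {suc n} (suc k) (s≤s k≤n) = trans (∑-suc _) (cong suc (size-below k k≤n))

⌊_²/4⌋ : ℕ → ℕ
⌊ n ²/4⌋ = n * n / 4

≤-with-slack : ∀ {a b} c → a + c ≡ b → a ≤ b
≤-with-slack c refl = m≤m+n _ c

[r+q*c]/c≡q : ∀ q r c .{{_ : NonZero c}} → r < c → (r + q * c) / c ≡ q
[r+q*c]/c≡q q r c r<c = trans (+-distrib-/ r (q * c) no-carry) (cong₂ _+_ (m<n⇒m/n≡0 r<c) (m*n/n≡m q c))
  where
  no-carry : r % c + (q * c) % c < c
  no-carry = subst (_< c) (sym (trans (cong₂ _+_ (m<n⇒m%n≡m r<c) (m*n%n≡0 q c)) (+-identityʳ r))) r<c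

even-or-odd : ∀ n → n ≡ 2 * (n / 2) ⊎ n ≡ 1 + 2 * (n / 2)
even-or-odd n with n % 2 | m%n<n n 2 | m≡m%n+[m/n]*n n 2
... | 0 | _ | n≡ = inj₁ (trans n≡ (*-comm (n / 2) 2))
... | 1 | _ | n≡ = inj₂ (trans n≡ (cong suc (*-comm (n / 2) 2)))
... | suc (suc _) | s≤s (s≤s ()) | _

⌊even²/4⌋ : ∀ k → ⌊ 2 * k ²/4⌋ ≡ k * k
⌊even²/4⌋ k = trans (cong (_/ 4) (square k)) ([r+q*c]/c≡q (k * k) 0 4 (s≤s z≤n))
  where
  square : ∀ k → (2 * k) * (2 * k) ≡ 0 + (k * k) * 4
  square = solve-∀

⌊odd²/4⌋ : ∀ k → ⌊ 1 + 2 * k ²/4⌋ ≡ k * k + k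
⌊odd²/4⌋ k = trans (cong (_/ 4) (square k)) ([r+q*c]/c≡q (k * k + k) 1 4 (s≤s (s≤s z≤n)))
  where
  square : ∀ k → (1 + 2 * k) * (1 + 2 * k) ≡ 1 + (k * k + k) * 4
  square = solve-∀

square≡4*⌊²/4⌋+r : ∀ n → ∃ λ r → r ≤ 1 × n * n ≡ 4 * ⌊ n ²/4⌋ + r
square≡4*⌊²/4⌋+r n with even-or-odd n
... | inj₁ n≡2k = 0 , z≤n , (begin
  n * n                          ≡⟨ cong (λ m → m * m) n≡2k ⟩
  (2 * k) * (2 * k)              ≡⟨ square k ⟩
  4 * (k * k) + 0                ≡⟨ cong (λ q → 4 * q + 0) (sym (⌊even²/4⌋ k)) ⟩
  4 * ⌊ 2 * k ²/4⌋ + 0           ≡⟨ cong (λ m → 4 * ⌊ m ²/4⌋ + 0) (sym n≡2k) ⟩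
  4 * ⌊ n ²/4⌋ + 0               ∎)
  where
  open ≡-Reasoning
  k : ℕ
  k = n / 2
  square : ∀ k → (2 * k) * (2 * k) ≡ 4 * (k * k) + 0
  square = solve-∀
... | inj₂ n≡1+2k = 1 , ≤-refl , (begin
  n * n                          ≡⟨ cong (λ m → m * m) n≡1+2k ⟩
  (1 + 2 * k) * (1 + 2 * k)      ≡⟨ square k ⟩
  4 * (k * k + k) + 1            ≡⟨ cong (λ q → 4 * q + 1) (sym (⌊odd²/4⌋ k)) ⟩
  4 * ⌊ 1 + 2 * k ²/4⌋ + 1       ≡⟨ cong (λ m → 4 * ⌊ m ²/4⌋ + 1) (sym n≡1+2k) ⟩
  4 * ⌊ n ²/4⌋ + 1               ∎)
  where
  open ≡-Reasoning
  k : ℕ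
  k = n / 2
  square : ∀ k → (1 + 2 * k) * (1 + 2 * k) ≡ 4 * (k * k + k) + 1
  square = solve-∀

≤⌊²/4⌋ : ∀ x n → 4 * x ≤ n * n + 2 → x ≤ ⌊ n ²/4⌋
≤⌊²/4⌋ x n 4x≤ with square≡4*⌊²/4⌋+r n
... | r , r≤1 , n²≡ = <⇒≤pred (*-cancelˡ-< 4 x (suc ⌊ n ²/4⌋) (begin-strict
  4 * x                    ≤⟨ 4x≤ ⟩
  n * n + 2                ≡⟨ cong (_+ 2) n²≡ ⟩
  4 * ⌊ n ²/4⌋ + r + 2     ≤⟨ +-monoˡ-≤ 2 (+-monoʳ-≤ (4 * ⌊ n ²/4⌋) r≤1) ⟩
  4 * ⌊ n ²/4⌋ + 1 + 2     <⟨ ≤-reflexive (next ⌊ n ²/4⌋) ⟩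
  4 * suc ⌊ n ²/4⌋         ∎))
  where
  open ≤-Reasoning
  next : ∀ q → suc (4 * q + 1 + 2) ≡ 4 * suc q
  next = solve-∀

≤-wlog : (P : ℕ → ℕ → Set) → (∀ a b → P a b → P b a) → (∀ a d → P a (a + d)) → ∀ a b → P a b
≤-wlog P symmetric ordered a b with ≤-total a b
... | inj₁ a≤b = subst (P a) (m+[n∸m]≡n a≤b) (ordered a (b ∸ a))
... | inj₂ b≤a = symmetric b a (subst (P b) (m+[n∸m]≡n b≤a) (ordered b (a ∸ b)))

square-of-sum : ∀ a d → (a + (a + d)) * (a + (a + d)) ≡ 4 * (a * (a + d)) + d * d
square-of-sum = solve-∀

4ab≤[a+b]² : ∀ a b → 4 * (a * b) ≤ (a + b) * (a + b)
4ab≤[a+b]² = ≤-wlog (λ a b → 4 * (a * b) ≤ (a + b) * (a + b)) symmetric ordered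
  where
  symmetric : ∀ a b → 4 * (a * b) ≤ (a + b) * (a + b) → 4 * (b * a) ≤ (b + a) * (b + a)
  symmetric a b = subst₂ _≤_ (cong (4 *_) (*-comm a b)) (cong (λ s → s * s) (+-comm a b))
  ordered : ∀ a d → 4 * (a * (a + d)) ≤ (a + (a + d)) * (a + (a + d))
  ordered a d = ≤-trans (m≤m+n _ (d * d)) (≤-reflexive (sym (square-of-sum a d)))

ab≤⌊[a+b]²/4⌋ : ∀ a b → a * b ≤ ⌊ a + b ²/4⌋
ab≤⌊[a+b]²/4⌋ a b = ≤⌊²/4⌋ (a * b) (a + b) (≤-trans (4ab≤[a+b]² a b) (m≤m+n _ 2))

ab≡⌊[a+b]²/4⌋⇒half : ∀ a b → a * b ≡ ⌊ a + b ²/4⌋ → a ≡ (a + b) / 2 ⊎ b ≡ (a + b) / 2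
ab≡⌊[a+b]²/4⌋⇒half = ≤-wlog P symmetric ordered
  where
  P : ℕ → ℕ → Set
  P a b = a * b ≡ ⌊ a + b ²/4⌋ → a ≡ (a + b) / 2 ⊎ b ≡ (a + b) / 2
  symmetric : ∀ a b → P a b → P b a
  symmetric a b Pab ab≡ with Pab (trans (*-comm a b) (trans ab≡ (cong ⌊_²/4⌋ (+-comm b a))))
  ... | inj₁ a≡ = inj₂ (trans a≡ (cong (_/ 2) (+-comm a b)))
  ... | inj₂ b≡ = inj₁ (trans b≡ (cong (_/ 2) (+-comm a b)))
  d≤1 : ∀ d → d * d ≤ 1 → d ≤ 1
  d≤1 zero          _ = z≤n
  d≤1 (suc zero)    _ = ≤-refl
  d≤1 (suc (suc d)) (s≤s ())
  ordered : ∀ a d → P a (a + d)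
  ordered a d ab≡ with square≡4*⌊²/4⌋+r (a + (a + d))
  ... | r , r≤1 , square≡ = inj₁ (sym (trans (cong (_/ 2) (twice a d)) ([r+q*c]/c≡q a d 2 (s≤s (d≤1 d d²≤1)))))
    where
    twice : ∀ a d → a + (a + d) ≡ d + a * 2
    twice = solve-∀
    d²≡r : d * d ≡ r
    d²≡r = +-cancelˡ-≡ (4 * (a * (a + d))) _ _
             (trans (sym (square-of-sum a d)) (trans square≡ (cong (λ q → 4 * q + r) (sym ab≡))))
    d²≤1 : d * d ≤ 1
    d²≤1 = ≤-trans (≤-reflexive d²≡r) r≤1

⌊²/4⌋+⌊suc²/4⌋ : ∀ n → 2 * (⌊ n ²/4⌋ + ⌊ suc n ²/4⌋) ≡ n * suc n
⌊²/4⌋+⌊suc²/4⌋ n with even-or-odd n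
... | inj₁ n≡2k = subst (λ m → 2 * (⌊ m ²/4⌋ + ⌊ suc m ²/4⌋) ≡ m * suc m) (sym n≡2k) (begin
  2 * (⌊ 2 * k ²/4⌋ + ⌊ 1 + 2 * k ²/4⌋)   ≡⟨ cong₂ (λ p q → 2 * (p + q)) (⌊even²/4⌋ k) (⌊odd²/4⌋ k) ⟩
  2 * (k * k + (k * k + k))               ≡⟨ identity k ⟩
  2 * k * suc (2 * k)                     ∎)
  where
  open ≡-Reasoning
  k : ℕ
  k = n / 2
  identity : ∀ k → 2 * (k * k + (k * k + k)) ≡ 2 * k * suc (2 * k)
  identity = solve-∀
... | inj₂ n≡1+2k = subst (λ m → 2 * (⌊ m ²/4⌋ + ⌊ suc m ²/4⌋) ≡ m * suc m) (sym n≡1+2k) (begin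
  2 * (⌊ 1 + 2 * k ²/4⌋ + ⌊ 2 + 2 * k ²/4⌋)   ≡⟨ cong (λ m → 2 * (⌊ 1 + 2 * k ²/4⌋ + ⌊ m ²/4⌋)) (double k) ⟩
  2 * (⌊ 1 + 2 * k ²/4⌋ + ⌊ 2 * suc k ²/4⌋)   ≡⟨ cong₂ (λ p q → 2 * (p + q)) (⌊odd²/4⌋ k) (⌊even²/4⌋ (suc k)) ⟩
  2 * (k * k + k + suc k * suc k)             ≡⟨ identity k ⟩
  (1 + 2 * k) * suc (1 + 2 * k)               ∎)
  where
  open ≡-Reasoning
  k : ℕ
  k = n / 2
  double : ∀ k → 2 + 2 * k ≡ 2 * suc k
  double = solve-∀
  identity : ∀ k → 2 * (k * k + k + suc k * suc k) ≡ (1 + 2 * k) * suc (1 + 2 * k)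
  identity = solve-∀

triangle-case-bound : ∀ E s → 7 ≤ s → 4 * E ≤ s * s + 4 * s + 12 → E + 3 ≤ ⌊ 3 + s ²/4⌋
triangle-case-bound E s 7≤s 4E≤ = ≤⌊²/4⌋ (E + 3) (3 + s) (begin
  4 * (E + 3)              ≡⟨ *-distribˡ-+ 4 E 3 ⟩
  4 * E + 12               ≤⟨ +-monoˡ-≤ 12 4E≤ ⟩
  s * s + 4 * s + 12 + 12  ≤⟨ slack s 7≤s ⟩
  (3 + s) * (3 + s) + 2    ∎)
  where
  open ≤-Reasoning
  identity : ∀ t → (7 + t) * (7 + t) + 4 * (7 + t) + 12 + 12 + (1 + 2 * t) ≡ (3 + (7 + t)) * (3 + (7 + t)) + 2
  identity = solve-∀
  slack : ∀ s → 7 ≤ s → s * s + 4 * s + 12 + 12 ≤ (3 + s) * (3 + s) + 2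
  slack s 7≤s with s ∸ 7 | m+[n∸m]≡n 7≤s
  ... | t | refl = ≤-with-slack (1 + 2 * t) (identity t)

4ab+10≤[a+b]²+2a : ∀ a b → 10 ≤ a + b → 4 * (a * b) + 10 ≤ (a + b) * (a + b) + 2 * a
4ab+10≤[a+b]²+2a a b 10≤a+b with ≤-total a b
... | inj₂ b≤a = +-mono-≤ (4ab≤[a+b]² a b) (≤-trans 10≤a+b (≤-reflexive-+ (+-monoʳ-≤ a b≤a)))
  where
  ≤-reflexive-+ : a + b ≤ a + a → a + b ≤ 2 * a
  ≤-reflexive-+ p = ≤-trans p (≤-reflexive (cong (a +_) (sym (+-identityʳ a))))
... | inj₁ a≤b with b ∸ a | m+[n∸m]≡n a≤b
...   | d | refl = begin
  4 * (a * (a + d)) + 10                         ≤⟨ +-monoʳ-≤ (4 * (a * (a + d))) 10≤a+b ⟩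
  4 * (a * (a + d)) + (a + (a + d))              ≡⟨ regroup a d ⟩
  4 * (a * (a + d)) + d + 2 * a                  ≤⟨ +-monoˡ-≤ (2 * a) (+-monoʳ-≤ (4 * (a * (a + d))) (d≤d² d)) ⟩
  4 * (a * (a + d)) + d * d + 2 * a              ≡⟨ cong (_+ 2 * a) (sym (square-of-sum a d)) ⟩
  (a + (a + d)) * (a + (a + d)) + 2 * a          ∎
  where
  open ≤-Reasoning
  regroup : ∀ a d → 4 * (a * (a + d)) + (a + (a + d)) ≡ 4 * (a * (a + d)) + d + 2 * a
  regroup = solve-∀
  d≤d² : ∀ d → d ≤ d * d
  d≤d² zero    = z≤n
  d≤d² (suc d) = m≤m*n (suc d) (suc d)

edge-case-bound : ∀ E a b → 10 ≤ a + b → 2 * E + a ≤ 2 * (a * b) → E + 3 ≤ ⌊ a + b ²/4⌋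
edge-case-bound E a b 10≤a+b 2E+a≤ = ≤⌊²/4⌋ (E + 3) (a + b) (+-cancelʳ-≤ (2 * a) _ _ (begin
  4 * (E + 3) + 2 * a                ≡⟨ regroup E a ⟩
  2 * (2 * E + a) + 12               ≤⟨ +-monoˡ-≤ 12 (*-monoʳ-≤ 2 2E+a≤) ⟩
  2 * (2 * (a * b)) + 12             ≡⟨ regroup′ (a * b) ⟩
  4 * (a * b) + 10 + 2               ≤⟨ +-monoˡ-≤ 2 (4ab+10≤[a+b]²+2a a b 10≤a+b) ⟩
  (a + b) * (a + b) + 2 * a + 2      ≡⟨ +-comm-last ((a + b) * (a + b)) (2 * a) 2 ⟩
  (a + b) * (a + b) + 2 + 2 * a      ∎))
  where
  open ≤-Reasoning
  regroup : ∀ E a → 4 * (E + 3) + 2 * a ≡ 2 * (2 * E + a) + 12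
  regroup = solve-∀
  regroup′ : ∀ p → 2 * (2 * p) + 12 ≡ 4 * p + 10 + 2
  regroup′ = solve-∀
  +-comm-last : ∀ x y z → x + y + z ≡ x + z + y
  +-comm-last = solve-∀

small-side-bound : ∀ E a b → 10 ≤ a + b → a ≤ 1 ⊎ b ≤ 1 → E ≤ a * b → E + 3 ≤ ⌊ a + b ²/4⌋
small-side-bound E a b 10≤a+b small E≤ab = ≤⌊²/4⌋ (E + 3) (a + b) (begin
  4 * (E + 3)                  ≡⟨ *-distribˡ-+ 4 E 3 ⟩
  4 * E + 12                   ≤⟨ +-monoˡ-≤ 12 (*-monoʳ-≤ 4 (≤-trans E≤ab (ab≤a+b small))) ⟩
  4 * (a + b) + 12             ≤⟨ slack (a + b) 10≤a+b ⟩
  (a + b) * (a + b) + 2        ∎)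
  where
  open ≤-Reasoning
  ab≤a+b : a ≤ 1 ⊎ b ≤ 1 → a * b ≤ a + b
  ab≤a+b (inj₁ a≤1) = ≤-trans (*-monoˡ-≤ b a≤1) (≤-trans (≤-reflexive (*-identityˡ b)) (m≤n+m b a))
  ab≤a+b (inj₂ b≤1) = ≤-trans (*-monoʳ-≤ a b≤1) (≤-trans (≤-reflexive (*-identityʳ a)) (m≤m+n a b))
  identity : ∀ t → 4 * (10 + t) + 12 + (50 + 16 * t + t * t) ≡ (10 + t) * (10 + t) + 2
  identity = solve-∀
  slack : ∀ s → 10 ≤ s → 4 * s + 12 ≤ s * s + 2
  slack s 10≤s with s ∸ 10 | m+[n∸m]≡n 10≤s
  ... | t | refl = ≤-with-slack (50 + 16 * t + t * t) (identity t)

half*rest≡⌊²/4⌋ : ∀ a b → a ≡ (a + b) / 2 → a * b ≡ ⌊ a + b ²/4⌋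
half*rest≡⌊²/4⌋ a b a≡h with (a + b) / 2 | even-or-odd (a + b)
... | h | inj₁ a+b≡2h rewrite a≡h = begin
  h * b               ≡⟨ cong (h *_) b≡h ⟩
  h * h               ≡⟨ sym (⌊even²/4⌋ h) ⟩
  ⌊ 2 * h ²/4⌋        ≡⟨ cong ⌊_²/4⌋ (sym a+b≡2h) ⟩
  ⌊ h + b ²/4⌋        ∎
  where
  open ≡-Reasoning
  b≡h : b ≡ h
  b≡h = +-cancelˡ-≡ h b h (trans a+b≡2h (cong (h +_) (+-identityʳ h)))
... | h | inj₂ a+b≡1+2h rewrite a≡h = begin
  h * b               ≡⟨ cong (h *_) b≡1+h ⟩
  h * (1 + h)         ≡⟨ identity h ⟩
  h * h + h           ≡⟨ sym (⌊odd²/4⌋ h) ⟩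
  ⌊ 1 + 2 * h ²/4⌋    ≡⟨ cong ⌊_²/4⌋ (sym a+b≡1+2h) ⟩
  ⌊ h + b ²/4⌋        ∎
  where
  open ≡-Reasoning
  identity : ∀ h → h * (1 + h) ≡ h * h + h
  identity = solve-∀
  shift : ∀ h → 1 + 2 * h ≡ h + (1 + h)
  shift = solve-∀
  b≡1+h : b ≡ 1 + h
  b≡1+h = +-cancelˡ-≡ h b (1 + h) (trans a+b≡1+2h (shift h))

mantel-step : ∀ d s → 2 * d ≤ s * s → 2 * (d + 2 * s + 2) ≤ (2 + s) * (2 + s)
mantel-step d s 2d≤s² = begin
  2 * (d + 2 * s + 2)  ≡⟨ expand d s ⟩
  2 * d + (4 * s + 4)  ≤⟨ +-monoˡ-≤ (4 * s + 4) 2d≤s² ⟩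
  s * s + (4 * s + 4)  ≡⟨ square s ⟩
  (2 + s) * (2 + s)    ∎
  where
  open ≤-Reasoning
  expand : ∀ d s → 2 * (d + 2 * s + 2) ≡ 2 * d + (4 * s + 4)
  expand = solve-∀
  square : ∀ s → s * s + (4 * s + 4) ≡ (2 + s) * (2 + s)
  square = solve-∀

triangle-step : ∀ d d₃ s₃ → d ≤ d₃ + 2 * s₃ + 6 → 2 * d₃ ≤ s₃ * s₃ ⊎ (s₃ ≡ 3 × d₃ ≤ 6) →
                2 * d ≤ (3 + s₃) * (3 + s₃) ⊎ (3 + s₃ ≡ 3 × d ≤ 6)
triangle-step d d₃ .3 d≤ (inj₂ (refl , d₃≤6)) = inj₁ (*-monoʳ-≤ 2 (≤-trans d≤ (+-monoˡ-≤ 6 (+-monoˡ-≤ 6 d₃≤6))))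
triangle-step d zero zero d≤ (inj₁ _) = inj₂ (refl , d≤)
triangle-step d zero (suc zero) d≤ (inj₁ _) = inj₁ (*-monoʳ-≤ 2 d≤)
triangle-step d (suc d₃) zero d≤ (inj₁ ())
triangle-step d (suc d₃) (suc zero) d≤ (inj₁ 2d₃≤1)
  with s≤s () ← ≤-trans (m≤m+n 2 (2 * d₃)) (subst (_≤ 1) (*-suc 2 d₃) 2d₃≤1)
triangle-step d d₃ (suc (suc t)) d≤ (inj₁ 2d₃≤s²) = inj₁ (begin
  2 * d                                    ≤⟨ *-monoʳ-≤ 2 d≤ ⟩
  2 * (d₃ + 2 * (2 + t) + 6)               ≡⟨ expand d₃ t ⟩
  2 * d₃ + (4 * t + 20)                    ≤⟨ +-monoˡ-≤ (4 * t + 20) 2d₃≤s² ⟩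
  (2 + t) * (2 + t) + (4 * t + 20)         ≤⟨ m≤m+n _ (2 * t + 1) ⟩
  (2 + t) * (2 + t) + (4 * t + 20) + (2 * t + 1) ≡⟨ square t ⟩
  (5 + t) * (5 + t)                        ∎)
  where
  open ≤-Reasoning
  expand : ∀ d t → 2 * (d + 2 * (2 + t) + 6) ≡ 2 * d + (4 * t + 20)
  expand = solve-∀
  square : ∀ t → (2 + t) * (2 + t) + (4 * t + 20) + (2 * t + 1) ≡ (5 + t) * (5 + t)
  square = solve-∀

module Counting {n} (K : Graph n) where

  deg : VSet n → Fin n → ℕ
  deg S u = ∑ λ v → b2n (S v) * b2n (adj K u v)

  edgesBetween : VSet n → VSet n → ℕ
  edgesBetween A B = ∑ λ u → b2n (A u) * deg B u

  degSum : VSet n → ℕ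
  degSum S = edgesBetween S S

  adj⇒≢ : ∀ {x y} → adj K x y ≡ true → x ≢ y
  adj⇒≢ {x} xy refl with () ← trans (sym xy) (adj-irrefl K x)

  edgesBetween-comm : ∀ A B → edgesBetween A B ≡ edgesBetween B A
  edgesBetween-comm A B = begin
    ∑ (λ u → b2n (A u) * ∑ (λ v → b2n (B v) * b2n (adj K u v)))   ≡⟨ ∑-cong (λ u → sym (∑-*ˡ (b2n (A u)) _)) ⟩
    ∑ (λ u → ∑ (λ v → b2n (A u) * (b2n (B v) * b2n (adj K u v)))) ≡⟨ ∑-swap _ ⟩
    ∑ (λ v → ∑ (λ u → b2n (A u) * (b2n (B v) * b2n (adj K u v)))) ≡⟨ ∑-cong (λ v → ∑-cong (λ u → swap u v)) ⟩
    ∑ (λ v → ∑ (λ u → b2n (B v) * (b2n (A u) * b2n (adj K v u)))) ≡⟨ ∑-cong (λ v → ∑-*ˡ (b2n (B v)) _) ⟩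
    ∑ (λ v → b2n (B v) * ∑ (λ u → b2n (A u) * b2n (adj K v u)))   ∎
    where
    open ≡-Reasoning
    swap : ∀ u v → b2n (A u) * (b2n (B v) * b2n (adj K u v)) ≡ b2n (B v) * (b2n (A u) * b2n (adj K v u))
    swap u v rewrite adj-sym K u v = x*[y*z]≡y*[x*z] (b2n (A u)) (b2n (B v)) (b2n (adj K v u))

  module _ {S A B : VSet n} (S≐A⊍B : S ≐ A ⊍ B) where

    deg-⊍ : ∀ u → deg S u ≡ deg A u + deg B u
    deg-⊍ u = trans (∑-cong (λ v → trans (cong (_* b2n (adj K u v)) (S≐A⊍B v)) (*-distribʳ-+ _ (b2n (A v)) _)))
                    (∑-+ _ _)

    edgesBetween-⊍ˡ : ∀ C → edgesBetween S C ≡ edgesBetween A C + edgesBetween B C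
    edgesBetween-⊍ˡ C = trans (∑-cong (λ u → trans (cong (_* deg C u) (S≐A⊍B u)) (*-distribʳ-+ _ (b2n (A u)) _)))
                              (∑-+ _ _)

    edgesBetween-⊍ʳ : ∀ C → edgesBetween C S ≡ edgesBetween C A + edgesBetween C B
    edgesBetween-⊍ʳ C = begin
      edgesBetween C S                       ≡⟨ edgesBetween-comm C S ⟩
      edgesBetween S C                       ≡⟨ edgesBetween-⊍ˡ C ⟩
      edgesBetween A C + edgesBetween B C    ≡⟨ cong₂ _+_ (edgesBetween-comm A C) (edgesBetween-comm B C) ⟩
      edgesBetween C A + edgesBetween C B    ∎
      where open ≡-Reasoning

    degSum-⊍ : degSum S ≡ degSum A + 2 * edgesBetween A B + degSum B
    degSum-⊍ = begin
      edgesBetween S S                                                 ≡⟨ edgesBetween-⊍ˡ S ⟩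
      edgesBetween A S + edgesBetween B S                              ≡⟨ cong₂ _+_ (edgesBetween-⊍ʳ A) (edgesBetween-⊍ʳ B) ⟩
      (degSum A + edgesBetween A B) + (edgesBetween B A + degSum B)    ≡⟨ cong (λ t → degSum A + edgesBetween A B + (t + degSum B)) (edgesBetween-comm B A) ⟩
      (degSum A + edgesBetween A B) + (edgesBetween A B + degSum B)    ≡⟨ regroup (degSum A) (edgesBetween A B) (degSum B) ⟩
      degSum A + 2 * edgesBetween A B + degSum B                       ∎
      where
      open ≡-Reasoning
      regroup : ∀ a b c → (a + b) + (b + c) ≡ a + 2 * b + c
      regroup = solve-∀

  deg-⁅⁆ : ∀ x u → deg ⁅ x ⁆ u ≡ b2n (adj K u x)
  deg-⁅⁆ x u = ∑-indicator x (λ v → b2n (adj K u v))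

  edgesBetween-⁅⁆ : ∀ A x → edgesBetween A ⁅ x ⁆ ≡ deg A x
  edgesBetween-⁅⁆ A x = ∑-cong (λ u → cong (b2n (A u) *_) (trans (deg-⁅⁆ x u) (cong b2n (adj-sym K u x))))

  degSum-⁅⁆ : ∀ x → degSum ⁅ x ⁆ ≡ 0
  degSum-⁅⁆ x = trans (edgesBetween-⁅⁆ ⁅ x ⁆ x) (trans (deg-⁅⁆ x x) (cong b2n (adj-irrefl K x)))

  deg-─ : ∀ S {x} → S x ≡ true → ∀ u → deg S u ≡ deg (S ─ x) u + b2n (adj K u x)
  deg-─ S {x} x∈S u = trans (deg-⊍ {S} {S ─ x} {⁅ x ⁆} (─-⊍-⁅⁆ {S = S} x∈S) u) (cong (deg (S ─ x) u +_) (deg-⁅⁆ x u))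

  degSum-─ : ∀ S {x} → S x ≡ true → degSum S ≡ degSum (S ─ x) + 2 * deg (S ─ x) x
  degSum-─ S {x} x∈S = begin
    degSum S                                                          ≡⟨ degSum-⊍ {S} {S ─ x} {⁅ x ⁆} (─-⊍-⁅⁆ {S = S} x∈S) ⟩
    degSum (S ─ x) + 2 * edgesBetween (S ─ x) ⁅ x ⁆ + degSum ⁅ x ⁆    ≡⟨ cong₂ (λ a b → degSum (S ─ x) + 2 * a + b)
                                                                                 (edgesBetween-⁅⁆ (S ─ x) x) (degSum-⁅⁆ x) ⟩
    degSum (S ─ x) + 2 * deg (S ─ x) x + 0                            ≡⟨ +-identityʳ _ ⟩
    degSum (S ─ x) + 2 * deg (S ─ x) x                                ∎
    where open ≡-Reasoning


  record Edge (S : VSet n) : Set where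
    constructor edge
    field
      {x y} : Fin n
      x∈S   : S x ≡ true
      y∈S   : S y ≡ true
      xy    : adj K x y ≡ true

  degSum-positive⇒Edge : ∀ S → 0 < degSum S → Edge S
  degSum-positive⇒Edge S 0<degSum with ∑-positive _ 0<degSum
  ... | x , 0<x-term with S x in x∈S
  ...   | true with ∑-positive _ (≤-trans 0<x-term (≤-reflexive (+-identityʳ _)))
  ...     | y , 0<y-term with S y in y∈S | adj K x y in xy
  ...       | true | true = edge x∈S y∈S xy

  Edge⇒degSum-positive : ∀ {S} → Edge S → 0 < degSum S
  Edge⇒degSum-positive {S} (edge {x} {y} x∈S y∈S xy) = begin
    1                               ≡⟨ sym (cong₂ (λ a b → b2n a * b2n b) y∈S xy) ⟩
    b2n (S y) * b2n (adj K x y)     ≤⟨ ∑-≥-term _ y ⟩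
    deg S x                         ≡⟨ sym (trans (cong (λ a → b2n a * deg S x) x∈S) (+-identityʳ (deg S x))) ⟩
    b2n (S x) * deg S x             ≤⟨ ∑-≥-term _ x ⟩
    degSum S                        ∎
    where open ≤-Reasoning

  record Triangle (S : VSet n) : Set where
    constructor triangle
    field
      {x y z} : Fin n
      x∈S     : S x ≡ true
      y∈S     : S y ≡ true
      z∈S     : S z ≡ true
      xy      : adj K x y ≡ true
      xz      : adj K x z ≡ true
      yz      : adj K y z ≡ true

  TriangleFree : VSet n → Set
  TriangleFree S = ¬ Triangle S

  triangle? : ∀ S → Dec (Triangle S)
  triangle? S = map′
    (λ { (_ , _ , _ , x∈S , y∈S , z∈S , xy , xz , yz) → triangle x∈S y∈S z∈S xy xz yz })
    (λ { (triangle {x} {y} {z} x∈S y∈S z∈S xy xz yz) → x , y , z , x∈S , y∈S , z∈S , xy , xz , yz })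
    (Finₚ.any? λ x → Finₚ.any? λ y → Finₚ.any? λ z →
      S x Boolₚ.≟ true ×-dec S y Boolₚ.≟ true ×-dec S z Boolₚ.≟ true ×-dec
      adj K x y Boolₚ.≟ true ×-dec adj K x z Boolₚ.≟ true ×-dec adj K y z Boolₚ.≟ true)

  Triangle-mono : ∀ {S T} → T ⊆ S → Triangle T → Triangle S
  Triangle-mono T⊆S (triangle x∈T y∈T z∈T xy xz yz) = triangle (T⊆S x∈T) (T⊆S y∈T) (T⊆S z∈T) xy xz yz

  zero-or-Edge : ∀ S → degSum S ≡ 0 ⊎ Edge S
  zero-or-Edge S with degSum S in degSum≡
  ... | zero  = inj₁ refl
  ... | suc _ = inj₂ (degSum-positive⇒Edge S (subst (0 <_) (sym degSum≡) (s≤s z≤n)))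

  deg-+-deg : ∀ S x y → deg S x + deg S y ≡ ∑ (λ w → b2n (S w) * (b2n (adj K x w) + b2n (adj K y w)))
  deg-+-deg S x y = sym (trans (∑-cong (λ w → *-distribˡ-+ (b2n (S w)) _ _)) (∑-+ _ _))

  degSum-─-─ : ∀ S {x y} → S x ≡ true → S y ≡ true → y ≢ x →
               degSum S ≡ degSum (S ─ x ─ y) + 2 * (deg (S ─ x ─ y) x + deg (S ─ x ─ y) y + b2n (adj K x y))
  degSum-─-─ S {x} {y} x∈S y∈S y≢x = begin
    degSum S                                                  ≡⟨ degSum-─ S x∈S ⟩
    degSum (S ─ x) + 2 * deg (S ─ x) x                        ≡⟨ cong₂ (λ a b → a + 2 * b) (degSum-─ (S ─ x) y∈S─x) (deg-─ (S ─ x) y∈S─x x) ⟩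
    degSum S₂ + 2 * deg S₂ y + 2 * (deg S₂ x + b2n (adj K x y)) ≡⟨ regroup (degSum S₂) (deg S₂ x) (deg S₂ y) _ ⟩
    degSum S₂ + 2 * (deg S₂ x + deg S₂ y + b2n (adj K x y))     ∎
    where
    open ≡-Reasoning
    S₂ : VSet n
    S₂ = S ─ x ─ y
    y∈S─x : (S ─ x) y ≡ true
    y∈S─x = ∈-─⁺ {S = S} y∈S y≢x
    regroup : ∀ d a b c → d + 2 * b + 2 * (a + c) ≡ d + 2 * (a + b + c)
    regroup = solve-∀

  degSum-─-─-─ : ∀ S {x y z} → S x ≡ true → S y ≡ true → S z ≡ true → y ≢ x → z ≢ x → z ≢ y →
    let S₃ = S ─ x ─ y ─ z in
    degSum S ≡ degSum S₃ + 2 * (deg S₃ x + deg S₃ y + deg S₃ z)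
                         + 2 * (b2n (adj K x y) + b2n (adj K x z) + b2n (adj K y z))
  degSum-─-─-─ S {x} {y} {z} x∈S y∈S z∈S y≢x z≢x z≢y = begin
    degSum S                                                          ≡⟨ degSum-─-─ S x∈S y∈S y≢x ⟩
    degSum S₂ + 2 * (deg S₂ x + deg S₂ y + b2n (adj K x y))             ≡⟨ cong₂ (λ a b → a + 2 * (b + deg S₂ y + b2n (adj K x y)))
                                                                                (degSum-─ S₂ z∈S₂) (deg-─ S₂ z∈S₂ x) ⟩
    degSum S₃ + 2 * deg S₃ z + 2 * (deg S₃ x + b2n (adj K x z) + deg S₂ y + b2n (adj K x y))
                                                                      ≡⟨ cong (λ b → degSum S₃ + 2 * deg S₃ z + 2 * (deg S₃ x + b2n (adj K x z) + b + b2n (adj K x y)))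
                                                                              (deg-─ S₂ z∈S₂ y) ⟩
    degSum S₃ + 2 * deg S₃ z + 2 * (deg S₃ x + b2n (adj K x z) + (deg S₃ y + b2n (adj K y z)) + b2n (adj K x y))
                                                                      ≡⟨ regroup (degSum S₃) (deg S₃ x) (deg S₃ y) (deg S₃ z) _ _ _ ⟩
    degSum S₃ + 2 * (deg S₃ x + deg S₃ y + deg S₃ z) + 2 * (b2n (adj K x y) + b2n (adj K x z) + b2n (adj K y z)) ∎
    where
    open ≡-Reasoning
    S₂ : VSet n
    S₂ = S ─ x ─ y
    S₃ : VSet n
    S₃ = S ─ x ─ y ─ z
    z∈S₂ : (S ─ x ─ y) z ≡ true
    z∈S₂ = ∈-─⁺ {S = S ─ x} (∈-─⁺ {S = S} z∈S z≢x) z≢y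
    regroup : ∀ d a b c xy xz yz → d + 2 * c + 2 * (a + xz + (b + yz) + xy) ≡ d + 2 * (a + b + c) + 2 * (xy + xz + yz)
    regroup = solve-∀

  removeEdge : ∀ S {x y} → S x ≡ true → S y ≡ true → adj K x y ≡ true →
               (∀ w → S w ≡ true → b2n (adj K x w) + b2n (adj K y w) ≤ 1) →
               degSum S ≤ degSum (S ─ x ─ y) + 2 * size (S ─ x ─ y) + 2
  removeEdge S {x} {y} x∈S y∈S xy sharesNone = begin
    degSum S                                                  ≡⟨ degSum-─-─ S x∈S y∈S (≢-sym (adj⇒≢ xy)) ⟩
    degSum S₂ + 2 * (deg S₂ x + deg S₂ y + b2n (adj K x y))   ≡⟨ cong (λ b → degSum S₂ + 2 * (deg S₂ x + deg S₂ y + b2n b)) xy ⟩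
    degSum S₂ + 2 * (deg S₂ x + deg S₂ y + 1)                 ≡⟨ regroup (degSum S₂) (deg S₂ x + deg S₂ y) ⟩
    degSum S₂ + 2 * (deg S₂ x + deg S₂ y) + 2                 ≤⟨ +-monoˡ-≤ 2 (+-monoʳ-≤ (degSum S₂) (*-monoʳ-≤ 2 degs≤size)) ⟩
    degSum S₂ + 2 * size S₂ + 2                               ∎
    where
    open ≤-Reasoning
    S₂ : VSet n
    S₂ = S ─ x ─ y
    regroup : ∀ d a → d + 2 * (a + 1) ≡ d + 2 * a + 2
    regroup = solve-∀
    degs≤size : deg S₂ x + deg S₂ y ≤ size S₂
    degs≤size = subst (_≤ size S₂) (sym (deg-+-deg S₂ x y))
      (∑-in-≤-size S₂ _ (λ w w∈S₂ → sharesNone w (proj₁ (∈-─⁻ {S = S} (proj₁ (∈-─⁻ {S = S ─ x} w∈S₂))))))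

  removeTriangle : ∀ S {x y z} → S x ≡ true → S y ≡ true → S z ≡ true →
                   adj K x y ≡ true → adj K x z ≡ true → adj K y z ≡ true →
                   (∀ w → w ≢ x → w ≢ y → w ≢ z → b2n (adj K x w) + b2n (adj K y w) + b2n (adj K z w) ≤ 1) →
                   degSum S ≤ degSum (S ─ x ─ y ─ z) + 2 * size (S ─ x ─ y ─ z) + 6
  removeTriangle S {x} {y} {z} x∈S y∈S z∈S xy xz yz sharesOne = begin
    degSum S                                           ≡⟨ degSum-─-─-─ S x∈S y∈S z∈S (≢-sym (adj⇒≢ xy)) (≢-sym (adj⇒≢ xz)) (≢-sym (adj⇒≢ yz)) ⟩
    degSum S₃ + 2 * degs + 2 * (b2n (adj K x y) + b2n (adj K x z) + b2n (adj K y z))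
                                                       ≡⟨ cong₂ (λ a b → degSum S₃ + 2 * degs + 2 * (b2n a + b2n (adj K x z) + b2n b)) xy yz ⟩
    degSum S₃ + 2 * degs + 2 * (1 + b2n (adj K x z) + 1)
                                                       ≡⟨ cong (λ c → degSum S₃ + 2 * degs + 2 * (1 + b2n c + 1)) xz ⟩
    degSum S₃ + 2 * degs + 6                           ≤⟨ +-monoˡ-≤ 6 (+-monoʳ-≤ (degSum S₃) (*-monoʳ-≤ 2 degs≤size)) ⟩
    degSum S₃ + 2 * size S₃ + 6                        ∎
    where
    open ≤-Reasoning
    S₃ : VSet n
    S₃ = S ─ x ─ y ─ z
    degs : ℕ
    degs = deg S₃ x + deg S₃ y + deg S₃ z
    degs≡ : degs ≡ ∑ (λ w → b2n (S₃ w) * (b2n (adj K x w) + b2n (adj K y w) + b2n (adj K z w)))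
    degs≡ = trans (cong (_+ deg S₃ z) (deg-+-deg S₃ x y))
                  (sym (trans (∑-cong (λ w → *-distribˡ-+ (b2n (S₃ w)) _ _)) (∑-+ _ _)))
    degs≤size : degs ≤ size S₃
    degs≤size = subst (_≤ size S₃) (sym degs≡) (∑-in-≤-size S₃ _ outside)
      where
      outside : ∀ w → S₃ w ≡ true → b2n (adj K x w) + b2n (adj K y w) + b2n (adj K z w) ≤ 1
      outside w w∈S₃ with ∈-─⁻ {S = S ─ x ─ y} w∈S₃
      ... | w∈S₂ , w≢z with ∈-─⁻ {S = S ─ x} w∈S₂
      ...   | w∈S₁ , w≢y = sharesOne w (proj₂ (∈-─⁻ {S = S} w∈S₁)) w≢y w≢z

  mantel : ∀ S → TriangleFree S → 2 * degSum S ≤ size S * size S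
  mantel S noTriangle = go S noTriangle (<-wellFounded (size S))
    where
    go : ∀ S → TriangleFree S → Acc _<_ (size S) → 2 * degSum S ≤ size S * size S
    go S noTriangle (acc smaller) with zero-or-Edge S
    ... | inj₁ degSum≡0 rewrite degSum≡0 = z≤n
    ... | inj₂ (edge {x} {y} x∈S y∈S xy) = begin
      2 * degSum S                          ≤⟨ *-monoʳ-≤ 2 (removeEdge S x∈S y∈S xy sharesNone) ⟩
      2 * (degSum S₂ + 2 * size S₂ + 2)     ≤⟨ mantel-step (degSum S₂) (size S₂) (go S₂ noTriangle₂ (smaller size₂<)) ⟩
      (2 + size S₂) * (2 + size S₂)         ≡⟨ cong (λ s → s * s) (sym size≡) ⟩
      size S * size S                       ∎
      where
      open ≤-Reasoning
      S₂ : VSet n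
      S₂ = S ─ x ─ y
      size≡ : size S ≡ 2 + size S₂
      size≡ = size-─-─ x∈S y∈S (≢-sym (adj⇒≢ xy))
      size₂< : size S₂ < size S
      size₂< = ≤-trans (n≤1+n _) (≤-reflexive (sym size≡))
      noTriangle₂ : TriangleFree S₂
      noTriangle₂ = noTriangle ∘ Triangle-mono (λ w∈S₂ → proj₁ (∈-─⁻ {S = S} (proj₁ (∈-─⁻ {S = S ─ x} w∈S₂))))
      sharesNone : ∀ w → S w ≡ true → b2n (adj K x w) + b2n (adj K y w) ≤ 1
      sharesNone w w∈S with adj K x w in xw | adj K y w in yw
      ... | true  | true  = ⊥-elim (noTriangle (triangle x∈S y∈S w∈S xy xw yw))
      ... | true  | false = ≤-refl
      ... | false | true  = ≤-refl
      ... | false | false = z≤n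

  OneNeighbourPerTriangle : Set
  OneNeighbourPerTriangle = ∀ {x y z} → adj K x y ≡ true → adj K x z ≡ true → adj K y z ≡ true →
    ∀ w → w ≢ x → w ≢ y → w ≢ z → b2n (adj K x w) + b2n (adj K y w) + b2n (adj K z w) ≤ 1

  module _ (oneNeighbour : OneNeighbourPerTriangle) where

    mantel-or-triangle : ∀ S → 2 * degSum S ≤ size S * size S ⊎ (size S ≡ 3 × degSum S ≤ 6)
    mantel-or-triangle S = go S (<-wellFounded (size S))
      where
      go : ∀ S → Acc _<_ (size S) → 2 * degSum S ≤ size S * size S ⊎ (size S ≡ 3 × degSum S ≤ 6)
      go S (acc smaller) with triangle? S
      ... | no noTriangle = inj₁ (mantel S noTriangle)
      ... | yes (triangle {x} {y} {z} x∈S y∈S z∈S xy xz yz) =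
        subst (λ s → 2 * degSum S ≤ s * s ⊎ (s ≡ 3 × degSum S ≤ 6)) (sym size≡)
          (triangle-step (degSum S) (degSum S₃) (size S₃)
            (removeTriangle S x∈S y∈S z∈S xy xz yz (oneNeighbour xy xz yz))
            (go S₃ (smaller size₃<)))
        where
        S₃ : VSet n
        S₃ = S ─ x ─ y ─ z
        size≡ : size S ≡ 3 + size S₃
        size≡ = size-─-─-─ x∈S y∈S z∈S (≢-sym (adj⇒≢ xy)) (≢-sym (adj⇒≢ xz)) (≢-sym (adj⇒≢ yz))
        size₃< : size S₃ < size S
        size₃< = ≤-trans (≤-trans (n≤1+n _) (n≤1+n _)) (≤-reflexive (sym size≡))

complement : ∀ {n} → Graph n → Graph n
complement G = record
  { adj    = λ i j → not (adj G i j) ∧ not (i == j)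
  ; sym    = λ i j → cong₂ (λ a b → not a ∧ not b) (adj-sym G i j) (==-sym i j)
  ; irrefl = λ i → trans (cong (λ b → not (adj G i i) ∧ not b) (==-refl i)) (∧-zeroʳ _)
  }

module _ {n} {G : Graph n} where

  adjᶜ-≢ : ∀ {i j} → i ≢ j → adj (complement G) i j ≡ not (adj G i j)
  adjᶜ-≢ {i} {j} i≢j rewrite ==-≢ i≢j with adj G i j
  ... | true  = refl
  ... | false = refl

  adjᶜ⇒¬adj : ∀ {i j} → adj (complement G) i j ≡ true → adj G i j ≡ false
  adjᶜ⇒¬adj {i} {j} ij with adj G i j
  ... | false = refl

  ¬adj⇒adjᶜ : ∀ {i j} → i ≢ j → adj G i j ≡ false → adj (complement G) i j ≡ true
  ¬adj⇒adjᶜ i≢j ij = trans (adjᶜ-≢ i≢j) (cong not ij)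

  adj+adjᶜ+diagonal : ∀ i j → b2n (adj G i j) + b2n (adj (complement G) i j) + b2n (j == i) ≡ 1
  adj+adjᶜ+diagonal i j rewrite ==-sym j i with i == j in i==j
  ... | true with refl ← ==⇒≡ {x = i} {j} i==j rewrite adj-irrefl G i = refl
  ... | false with adj G i j
  ...   | true  = refl
  ...   | false = refl

  Is4-2⇒OneNeighbourPerTriangle : Is4-2 G → Counting.OneNeighbourPerTriangle (complement G)
  Is4-2⇒OneNeighbourPerTriangle (_ , twoEdges) {x} {y} {z} xy xz yz w w≢x w≢y w≢z =
    count (twoEdges x y z w (adj⇒≢ xy) (adj⇒≢ xz) (≢-sym w≢x) (adj⇒≢ yz) (≢-sym w≢y) (≢-sym w≢z))
    where
    open Counting (complement G) using (adj⇒≢)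
    count : 2 ≤ edges4 G x y z w →
            b2n (adj (complement G) x w) + b2n (adj (complement G) y w) + b2n (adj (complement G) z w) ≤ 1
    count two≤ rewrite adjᶜ⇒¬adj xy | adjᶜ⇒¬adj xz | adjᶜ⇒¬adj yz
                     | adjᶜ-≢ (≢-sym w≢x) | adjᶜ-≢ (≢-sym w≢y) | adjᶜ-≢ (≢-sym w≢z)
                     with adj G x w | adj G y w | adj G z w
    ... | true  | true  | true  = z≤n
    ... | true  | true  | false = ≤-refl
    ... | true  | false | true  = ≤-refl
    ... | false | true  | true  = ≤-refl
    ... | true  | false | false with s≤s () ← two≤
    ... | false | true  | false with s≤s () ← two≤
    ... | false | false | true  with s≤s () ← two≤
    ... | false | false | false with () ← two≤

∑∑adj : ∀ {n} → Graph n → ℕ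
∑∑adj K = ∑ λ i → ∑ λ j → b2n (adj K i j)

2*e≡∑∑adj : ∀ {n} (K : Graph n) → 2 * e K ≡ ∑∑adj K
2*e≡∑∑adj {n} K = begin
  2 * e K                                  ≡⟨ cong (λ t → t + (t + 0)) e≡∑∑below ⟩
  ∑∑ below + (∑∑ below + 0)                ≡⟨ cong (∑∑ below +_) (trans (+-identityʳ _) (∑-swap _)) ⟩
  ∑∑ below + ∑∑ (λ i j → below j i)        ≡⟨ sym (trans (∑-cong (λ i → ∑-+ _ _)) (∑-+ _ _)) ⟩
  ∑∑ (λ i j → below i j + below j i)       ≡⟨ ∑-cong (λ i → ∑-cong (λ j → sym (split i j))) ⟩
  ∑∑adj K                                  ∎
  where
  open ≡-Reasoning
  ∑∑ : (Fin n → Fin n → ℕ) → ℕ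
  ∑∑ f = ∑ λ i → ∑ λ j → f i j
  below : Fin n → Fin n → ℕ
  below i j = b2n (adj K i j ∧ (toℕ i <ᵇ toℕ j))
  if≡b2n : ∀ b → (if b then 1 else 0) ≡ b2n b
  if≡b2n true  = refl
  if≡b2n false = refl
  e≡∑∑below : e K ≡ ∑∑ below
  e≡∑∑below = trans (∑-allFin _) (∑-cong (λ i → trans (∑-allFin _) (∑-cong (λ j → if≡b2n _))))
  split : ∀ i j → b2n (adj K i j) ≡ below i j + below j i
  split i j rewrite adj-sym K j i with adj K i j in ij | <-cmp (toℕ i) (toℕ j)
  ... | false | _ = refl
  ... | true | tri< i<j _ _ rewrite <ᵇ-true i<j | <ᵇ-false (<⇒≤ i<j) = refl
  ... | true | tri> _ _ j<i rewrite <ᵇ-true j<i | <ᵇ-false (<⇒≤ j<i) = refl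
  ... | true | tri≈ _ i≡j _ with refl ← Finₚ.toℕ-injective i≡j with () ← trans (sym ij) (adj-irrefl K i)

e-≅ : ∀ {n} {G H : Graph n} → G ≅ H → e G ≡ e H
e-≅ {G = G} {H} (σ , preserves) = *-cancelˡ-≡ (e G) (e H) 2 (begin
  2 * e G                                                      ≡⟨ 2*e≡∑∑adj G ⟩
  ∑∑adj G                                                      ≡⟨ sym (∑-permute _ σ) ⟩
  ∑ (λ i → ∑ λ j → b2n (adj G (to i) j))                       ≡⟨ ∑-cong (λ i → sym (∑-permute _ σ)) ⟩
  ∑ (λ i → ∑ λ j → b2n (adj G (to i) (to j)))                  ≡⟨ ∑-cong (λ i → ∑-cong (λ j → cong b2n (preserves i j))) ⟩
  ∑∑adj H                                                      ≡⟨ sym (2*e≡∑∑adj H) ⟩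
  2 * e H                                                      ∎)
  where
  open ≡-Reasoning
  open Inverse σ using (to)

degSum-full≡2*e : ∀ {n} (K : Graph n) → Counting.degSum K full ≡ 2 * e K
degSum-full≡2*e K = trans (∑-cong (λ u → trans (+-identityʳ _) (∑-cong (λ v → +-identityʳ _)))) (sym (2*e≡∑∑adj K))

2*e+2*eᶜ+n≡n² : ∀ {n} (G : Graph n) → 2 * e G + 2 * e (complement G) + n ≡ n * n
2*e+2*eᶜ+n≡n² {n} G = begin
  2 * e G + 2 * e Gᶜ + n
    ≡⟨ cong₂ _+_ (cong₂ _+_ (2*e≡∑∑adj G) (2*e≡∑∑adj Gᶜ)) (sym diagonal) ⟩
  ∑∑adj G + ∑∑adj Gᶜ + ∑ (λ i → ∑ λ j → b2n (j == i))
    ≡⟨ sym (trans (∑-cong (λ i → trans (∑-+ _ _) (cong (_+ _) (∑-+ _ _)))) (trans (∑-+ _ _) (cong (_+ _) (∑-+ _ _)))) ⟩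
  ∑ (λ i → ∑ λ j → b2n (adj G i j) + b2n (adj Gᶜ i j) + b2n (j == i))
    ≡⟨ ∑-cong (λ i → ∑-cong (adj+adjᶜ+diagonal {G = G} i)) ⟩
  ∑ (λ i → ∑ λ j → 1)
    ≡⟨ trans (∑-cong (λ i → ∑-const n 1)) (∑-const n (n * 1)) ⟩
  n * (n * 1)
    ≡⟨ cong (n *_) (*-identityʳ n) ⟩
  n * n ∎
  where
  open ≡-Reasoning
  Gᶜ : Graph n
  Gᶜ = complement G
  diagonal : ∑ (λ i → ∑ λ j → b2n (j == i)) ≡ n
  diagonal = trans (∑-cong (λ i → trans (∑-cong (λ j → sym (*-identityʳ _))) (∑-indicator i (λ _ → 1))))
                   (trans (∑-const n 1) (*-identityʳ n))

e+eᶜ+2≡bound+⌊²/4⌋ : ∀ {n} (G : Graph n) → 1 ≤ n → e G + e (complement G) + 2 ≡ bound n + ⌊ n ²/4⌋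
e+eᶜ+2≡bound+⌊²/4⌋ {suc m} G _ = begin
  e G + e (complement G) + 2                     ≡⟨ cong (_+ 2) halves ⟩
  ⌊ m ²/4⌋ + ⌊ suc m ²/4⌋ + 2                    ≡⟨ +-comm-last ⌊ m ²/4⌋ ⌊ suc m ²/4⌋ 2 ⟩
  ⌊ m ²/4⌋ + 2 + ⌊ suc m ²/4⌋                    ∎
  where
  open ≡-Reasoning
  +-comm-last : ∀ x y z → x + y + z ≡ x + z + y
  +-comm-last = solve-∀
  double : 2 * (e G + e (complement G)) ≡ 2 * (⌊ m ²/4⌋ + ⌊ suc m ²/4⌋)
  double = +-cancelʳ-≡ (suc m) _ _ (begin
    2 * (e G + e (complement G)) + suc m         ≡⟨ cong (_+ suc m) (*-distribˡ-+ 2 (e G) _) ⟩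
    2 * e G + 2 * e (complement G) + suc m       ≡⟨ 2*e+2*eᶜ+n≡n² G ⟩
    suc m * suc m                                ≡⟨ *-comm (suc m) (suc m) ⟩
    suc m + m * suc m                            ≡⟨ +-comm (suc m) _ ⟩
    m * suc m + suc m                            ≡⟨ cong (_+ suc m) (sym (⌊²/4⌋+⌊suc²/4⌋ m)) ⟩
    2 * (⌊ m ²/4⌋ + ⌊ suc m ²/4⌋) + suc m        ∎)
  halves : e G + e (complement G) ≡ ⌊ m ²/4⌋ + ⌊ suc m ²/4⌋
  halves = *-cancelˡ-≡ _ _ 2 double

module _ {n} (G : Graph n) where
  private
    module K = Counting G
    module Kᶜ = Counting (complement G)

  degᶜ+deg≡size : ∀ S u → S u ≡ false → Kᶜ.deg S u + K.deg S u ≡ size S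
  degᶜ+deg≡size S u u∉S = trans (sym (∑-+ _ _)) (∑-cong pointwise)
    where
    pointwise : ∀ v → b2n (S v) * b2n (adj (complement G) u v) + b2n (S v) * b2n (adj G u v) ≡ b2n (S v)
    pointwise v with S v in v∈S
    ... | false = refl
    ... | true rewrite ==-≢ {x = u} {v} (λ { refl → case trans (sym u∉S) v∈S of λ () }) with adj G u v
    ...   | true  = refl
    ...   | false = refl

  edgesBetweenᶜ+edgesBetween≡ : ∀ A B → (∀ u → A u ≡ true → B u ≡ false) →
                                Kᶜ.edgesBetween A B + K.edgesBetween A B ≡ size B * size A
  edgesBetweenᶜ+edgesBetween≡ A B disjoint = begin
    Kᶜ.edgesBetween A B + K.edgesBetween A B             ≡⟨ sym (∑-+ _ _) ⟩
    ∑ (λ u → b2n (A u) * Kᶜ.deg B u + b2n (A u) * K.deg B u) ≡⟨ ∑-cong pointwise ⟩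
    ∑ (λ u → size B * b2n (A u))                          ≡⟨ ∑-*ˡ (size B) _ ⟩
    size B * size A                                       ∎
    where
    open ≡-Reasoning
    pointwise : ∀ u → b2n (A u) * Kᶜ.deg B u + b2n (A u) * K.deg B u ≡ size B * b2n (A u)
    pointwise u with A u in u∈A
    ... | false = sym (*-zeroʳ (size B))
    ... | true  = trans (cong₂ _+_ (+-identityʳ (Kᶜ.deg B u)) (+-identityʳ (K.deg B u)))
                        (trans (degᶜ+deg≡size B u (disjoint u u∈A)) (sym (*-identityʳ _)))

  degSumᶜ-clique : ∀ S → (∀ {x y} → S x ≡ true → S y ≡ true → x ≢ y → adj G x y ≡ true) → Kᶜ.degSum S ≡ 0
  degSumᶜ-clique S clique with Kᶜ.zero-or-Edge S
  ... | inj₁ degSum≡0 = degSum≡0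
  ... | inj₂ (Kᶜ.edge x∈S y∈S xy) with () ← trans (sym (adjᶜ⇒¬adj {G = G} xy)) (clique x∈S y∈S (Kᶜ.adj⇒≢ xy))

module _ {n} {G : Graph n} where

  Reach-head : ∀ {P u x} → Reach G P u x → P u
  Reach-head (here Pu)     = Pu
  Reach-head (step Pu _ _) = Pu

  crossing : ∀ {P} (N : VSet n) {u x} → Reach G P u x → N u ≡ true → N x ≡ false →
             ∃₂ λ a b → P a × P b × N a ≡ true × N b ≡ false × adj G a b ≡ true
  crossing N (here _) u∈N x∉N with () ← trans (sym u∈N) x∉N
  crossing N {u} (step {w = y} Pu uy walk) u∈N x∉N with N y in y∈N
  ... | false = u , y , Pu , Reach-head walk , u∈N , y∈N , uy
  ... | true  = crossing N walk y∈N x∉N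

record TwoDisjointCrossEdges {n} (G : Graph n) (N : VSet n) : Set where
  constructor crossEdges
  field
    {p₁ p₂ q₁ q₂} : Fin n
    p₁∈N  : N p₁ ≡ true
    p₂∈N  : N p₂ ≡ true
    q₁∉N  : N q₁ ≡ false
    q₂∉N  : N q₂ ≡ false
    p₁≢p₂ : p₁ ≢ p₂
    q₁≢q₂ : q₁ ≢ q₂
    p₁q₁  : adj G p₁ q₁ ≡ true
    p₂q₂  : adj G p₂ q₂ ≡ true

twoDisjointCrossEdges : ∀ {n} {G : Graph n} {N : VSet n} → TwoConnected G →
                        2 ≤ size N → 2 ≤ size (∁ N) → TwoDisjointCrossEdges G N
twoDisjointCrossEdges {G = G} {N} (_ , connected , connected-without) 2≤N 2≤∁N
  with ∃-∈ N (≤-trans (s≤s z≤n) 2≤N) | ∃-∈ (∁ N) (≤-trans (s≤s z≤n) 2≤∁N)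
... | u , u∈N | v , v∈∁N
  with crossing N (connected u v) u∈N (∁⇒∉ {S = N} v∈∁N)
... | a₁ , b₁ , _ , _ , a₁∈N , b₁∉N , a₁b₁
  with ∃-∈-≢ N 2≤N a₁
... | u′ , u′∈N , u′≢a₁
  with crossing N (connected-without a₁ u′ v u′≢a₁ (∉≢∈ {S = N} (∁⇒∉ {S = N} v∈∁N) a₁∈N)) u′∈N (∁⇒∉ {S = N} v∈∁N)
... | a₂ , b₂ , a₂≢a₁ , _ , a₂∈N , b₂∉N , a₂b₂
  with b₂ Finₚ.≟ b₁
... | no b₂≢b₁ = crossEdges a₁∈N a₂∈N b₁∉N b₂∉N (≢-sym a₂≢a₁) (≢-sym b₂≢b₁) a₁b₁ a₂b₂
... | yes refl
  with ∃-∈-≢ (∁ N) 2≤∁N b₁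
... | v′ , v′∈∁N , v′≢b₁
  with crossing N (connected-without b₁ a₁ v′ (≢-sym (∉≢∈ {S = N} b₁∉N a₁∈N)) v′≢b₁) a₁∈N (∁⇒∉ {S = N} v′∈∁N)
... | a₃ , b₃ , _ , b₃≢b₁ , a₃∈N , b₃∉N , a₃b₃
  with a₃ Finₚ.≟ a₁
... | no a₃≢a₁ = crossEdges a₁∈N a₃∈N b₁∉N b₃∉N (≢-sym a₃≢a₁) (≢-sym b₃≢b₁) a₁b₁ a₃b₃
... | yes refl = crossEdges a₁∈N a₂∈N b₃∉N b₁∉N (≢-sym a₂≢a₁) b₃≢b₁ a₃b₃ a₂b₂

record TwoCliquesJoinedBy {n} (G : Graph n) (P : VSet n) (joins : TwoDisjointCrossEdges G P) : Set where
  open TwoDisjointCrossEdges joins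
  field
    clique    : ∀ {x y} → P x ≡ P y → x ≢ y → adj G x y ≡ true
    onlyCross : ∀ {x y} → P x ≡ true → P y ≡ false → adj G x y ≡ true → (x ≡ p₁ × y ≡ q₁) ⊎ (x ≡ p₂ × y ≡ q₂)

module _ {n} {G : Graph n} {P : VSet n} where

  ∁-crossEdges : TwoDisjointCrossEdges G P → TwoDisjointCrossEdges G (∁ P)
  ∁-crossEdges (crossEdges p₁∈P p₂∈P q₁∉P q₂∉P p₁≢p₂ q₁≢q₂ p₁q₁ p₂q₂) =
    crossEdges (∉⇒∁ {S = P} q₁∉P) (∉⇒∁ {S = P} q₂∉P) (cong not p₁∈P) (cong not p₂∈P) q₁≢q₂ p₁≢p₂
               (trans (adj-sym G _ _) p₁q₁) (trans (adj-sym G _ _) p₂q₂)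

  ∁-TwoCliquesJoinedBy : ∀ {joins} → TwoCliquesJoinedBy G P joins → TwoCliquesJoinedBy G (∁ P) (∁-crossEdges joins)
  ∁-TwoCliquesJoinedBy shape = record
    { clique    = λ same x≢y → clique (not-injective same) x≢y
    ; onlyCross = λ x∈∁P y∉∁P xy → swap (onlyCross (∁∉⇒∈ {S = P} y∉∁P) (∁⇒∉ {S = P} x∈∁P) (trans (adj-sym G _ _) xy))
    }
    where
    open TwoCliquesJoinedBy shape
    swap : ∀ {A B C D : Set} → (A × B) ⊎ (C × D) → (B × A) ⊎ (D × C)
    swap (inj₁ (a , b)) = inj₁ (b , a)
    swap (inj₂ (c , d)) = inj₂ (d , c)

module _ {n} {G : Graph n} {P : VSet n} {joins : TwoDisjointCrossEdges G P} (shape : TwoCliquesJoinedBy G P joins) where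
  open TwoDisjointCrossEdges joins
  open TwoCliquesJoinedBy shape
  private
    module K = Counting G
    module Kᶜ = Counting (complement G)

  private
    off-edge : ∀ {u v p q} → adj G u v ≡ false → adj G p q ≡ true → b2n (v == q) * b2n (u == p) ≡ 0
    off-edge {u} {v} {p} {q} uv pq with v == q in v==q | u == p in u==p
    ... | false | _     = refl
    ... | true  | false = refl
    ... | true  | true with refl ← ==⇒≡ {x = v} {q} v==q | refl ← ==⇒≡ {x = u} {p} u==p
                       with () ← trans (sym uv) pq

    cross-row : ∀ {u} → P u ≡ true → ∀ v →
                b2n (∁ P v) * b2n (adj G u v) ≡ b2n (v == q₁) * b2n (u == p₁) + b2n (v == q₂) * b2n (u == p₂)
    cross-row {u} u∈P v with P v in v∈P | adj G u v in uv
    ... | true  | _ rewrite ==-≢ (∉≢∈ {S = P} q₁∉N v∈P ∘ sym) | ==-≢ (∉≢∈ {S = P} q₂∉N v∈P ∘ sym) = refl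
    ... | false | false = sym (cong₂ _+_ (off-edge uv p₁q₁) (off-edge uv p₂q₂))
    ... | false | true with onlyCross u∈P v∈P uv
    ...   | inj₁ (refl , refl) rewrite ==-refl q₁ | ==-refl p₁ | ==-≢ q₁≢q₂ = refl
    ...   | inj₂ (refl , refl) rewrite ==-refl q₂ | ==-refl p₂ | ==-≢ (q₁≢q₂ ∘ sym) = refl

    deg-cross : ∀ {u} → P u ≡ true → K.deg (∁ P) u ≡ b2n (u == p₁) + b2n (u == p₂)
    deg-cross {u} u∈P = trans (∑-cong (cross-row u∈P))
      (trans (∑-+ _ _) (cong₂ _+_ (∑-indicator q₁ (λ _ → b2n (u == p₁))) (∑-indicator q₂ (λ _ → b2n (u == p₂)))))

    edgesBetween-cross : K.edgesBetween P (∁ P) ≡ 2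
    edgesBetween-cross = trans (∑-cong pointwise)
      (trans (∑-+ _ _) (cong₂ _+_ (∑-indicator p₁ (λ _ → 1)) (∑-indicator p₂ (λ _ → 1))))
      where
      pointwise : ∀ u → b2n (P u) * K.deg (∁ P) u ≡ b2n (u == p₁) * 1 + b2n (u == p₂) * 1
      pointwise u with P u in u∈P
      ... | true  = trans (+-identityʳ _) (trans (deg-cross u∈P) (sym (cong₂ _+_ (*-identityʳ (b2n (u == p₁))) (*-identityʳ (b2n (u == p₂))))))
      ... | false rewrite ==-≢ (∉≢∈ {S = P} u∈P p₁∈N) | ==-≢ (∉≢∈ {S = P} u∈P p₂∈N) = refl

  eᶜ+2≡size*size : e (complement G) + 2 ≡ size P * size (∁ P)
  eᶜ+2≡size*size = *-cancelˡ-≡ _ _ 2 (begin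
    2 * (e (complement G) + 2)                                ≡⟨ *-distribˡ-+ 2 (e (complement G)) 2 ⟩
    2 * e (complement G) + 4                                  ≡⟨ cong (_+ 4) (sym (degSum-full≡2*e (complement G))) ⟩
    Kᶜ.degSum full + 4                                        ≡⟨ cong (_+ 4) (Kᶜ.degSum-⊍ {full} {P} {∁ P} (full≐S⊍∁S P)) ⟩
    Kᶜ.degSum P + 2 * Kᶜ.edgesBetween P (∁ P) + Kᶜ.degSum (∁ P) + 4
                                                              ≡⟨ cong₂ (λ a b → a + 2 * Kᶜ.edgesBetween P (∁ P) + b + 4)
                                                                       (degSumᶜ-clique G P (λ x∈P y∈P → clique (trans x∈P (sym y∈P))))
                                                                       (degSumᶜ-clique G (∁ P) (λ x∈∁P y∈∁P → clique (not-injective (trans x∈∁P (sym y∈∁P))))) ⟩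
    2 * Kᶜ.edgesBetween P (∁ P) + 0 + 4                       ≡⟨ cong (λ m → 2 * Kᶜ.edgesBetween P (∁ P) + 0 + 2 * m) (sym edgesBetween-cross) ⟩
    2 * Kᶜ.edgesBetween P (∁ P) + 0 + 2 * K.edgesBetween P (∁ P)
                                                              ≡⟨ cong (_+ 2 * K.edgesBetween P (∁ P)) (+-identityʳ (2 * Kᶜ.edgesBetween P (∁ P))) ⟩
    2 * Kᶜ.edgesBetween P (∁ P) + 2 * K.edgesBetween P (∁ P)  ≡⟨ sym (*-distribˡ-+ 2 (Kᶜ.edgesBetween P (∁ P)) (K.edgesBetween P (∁ P))) ⟩
    2 * (Kᶜ.edgesBetween P (∁ P) + K.edgesBetween P (∁ P))    ≡⟨ cong (2 *_) (edgesBetweenᶜ+edgesBetween≡ G P (∁ P) (λ u u∈P → cong not u∈P)) ⟩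
    2 * (size (∁ P) * size P)                                 ≡⟨ cong (2 *_) (*-comm (size (∁ P)) (size P)) ⟩
    2 * (size P * size (∁ P))                                 ∎)
    where open ≡-Reasoning

injective⇒surjective : ∀ {n} (f : Fin n → Fin n) → (∀ {x y} → f x ≡ f y → x ≡ y) → ∀ i → ∃ λ x → f x ≡ i
injective⇒surjective {suc n} f f-injective i with Finₚ.any? (λ x → f x Finₚ.≟ i)
... | yes hit = hit
... | no miss = pigeonhole
  where
  g : Fin (suc n) → Fin n
  g x = punchOut {i = i} {j = f x} (λ i≡fx → miss (x , sym i≡fx))
  g-injective : ∀ {x y} → g x ≡ g y → x ≡ y
  g-injective {x} {y} gx≡gy =
    f-injective (Finₚ.punchOut-injective (λ i≡fx → miss (x , sym i≡fx)) (λ i≡fy → miss (y , sym i≡fy)) gx≡gy)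
  pigeonhole : ∃ λ x → f x ≡ i
  pigeonhole with () ← <-irrefl refl (Finₚ.injective⇒≤ g-injective)

module Ranking {n} (key : Fin n → ℕ) where

  code : Fin n → ℕ
  code x = key x * n + toℕ x

  code-< : ∀ {x y} → key y < key x → code y < code x
  code-< {x} {y} ky<kx = begin-strict
    key y * n + toℕ y      <⟨ +-monoʳ-< (key y * n) (Finₚ.toℕ<n y) ⟩
    key y * n + n          ≡⟨ +-comm (key y * n) n ⟩
    suc (key y) * n        ≤⟨ *-monoˡ-≤ n ky<kx ⟩
    key x * n              ≤⟨ m≤m+n (key x * n) (toℕ x) ⟩
    key x * n + toℕ x      ∎
    where open ≤-Reasoning

  code-<⇒key-≤ : ∀ {x y} → code y < code x → key y ≤ key x
  code-<⇒key-≤ {x} {y} cy<cx = ≮⇒≥ (λ kx<ky → <-asym cy<cx (code-< kx<ky))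

  code-injective : ∀ {x y} → code x ≡ code y → x ≡ y
  code-injective {x} {y} cx≡cy with <-cmp (key x) (key y)
  ... | tri< kx<ky _ _ with () ← <-irrefl cx≡cy (code-< kx<ky)
  ... | tri> _ _ ky<kx with () ← <-irrefl (sym cx≡cy) (code-< ky<kx)
  ... | tri≈ _ kx≡ky _ = Finₚ.toℕ-injective (+-cancelˡ-≡ (key x * n) _ _ (trans cx≡cy (cong (λ k → k * n + toℕ y) (sym kx≡ky))))

  below : Fin n → VSet n
  below x y = code y <ᵇ code x

  rank : Fin n → ℕ
  rank x = size (below x)

  x∉below-x : ∀ x → below x x ≡ false
  x∉below-x x = <ᵇ-false (≤-refl {code x})

  rank<n : ∀ x → rank x < n
  rank<n x = subst (rank x <_) (size-full n) (size-mono-⊂ (λ _ → refl) (x∉below-x x) refl)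

  rank-mono : ∀ {x y} → code x < code y → rank x < rank y
  rank-mono {x} {y} cx<cy = size-mono-⊂ (λ w∈below-x → <ᵇ-true (<-trans (<ᵇ-true⇒< w∈below-x) cx<cy)) (x∉below-x x) (<ᵇ-true cx<cy)

  rank-injective : ∀ {x y} → rank x ≡ rank y → x ≡ y
  rank-injective {x} {y} rx≡ry with <-cmp (code x) (code y)
  ... | tri< cx<cy _ _ with () ← <-irrefl rx≡ry (rank-mono cx<cy)
  ... | tri> _ _ cy<cx with () ← <-irrefl (sym rx≡ry) (rank-mono cy<cx)
  ... | tri≈ _ cx≡cy _ = code-injective cx≡cy

  rank-≡ᵇ : ∀ x y → (rank x ≡ᵇ rank y) ≡ (x == y)
  rank-≡ᵇ x y with x Finₚ.≟ y
  ... | yes refl = ≡ᵇ-true {rank x} refl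
  ... | no x≢y  = ≡ᵇ-false (x≢y ∘ rank-injective)

  position : Fin n → Fin n
  position x = fromℕ< (rank<n x)

  position-injective : ∀ {x y} → position x ≡ position y → x ≡ y
  position-injective {x} {y} px≡py =
    rank-injective (trans (sym (Finₚ.toℕ-fromℕ< (rank<n x))) (trans (cong toℕ px≡py) (Finₚ.toℕ-fromℕ< (rank<n y))))

  vertexAt : Fin n → Fin n
  vertexAt i = proj₁ (injective⇒surjective position position-injective i)

  position-vertexAt : ∀ i → position (vertexAt i) ≡ i
  position-vertexAt i = proj₂ (injective⇒surjective position position-injective i)

  vertexAt↔ : Fin n ↔ Fin n
  vertexAt↔ = mk↔ₛ′ vertexAt position (λ x → position-injective (position-vertexAt (position x))) position-vertexAt

  toℕ≡rank-vertexAt : ∀ i → toℕ i ≡ rank (vertexAt i)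
  toℕ≡rank-vertexAt i = trans (cong toℕ (sym (position-vertexAt i))) (Finₚ.toℕ-fromℕ< (rank<n (vertexAt i)))

  below-by-key : ∀ {x} → (∀ {y} → key y ≡ key x → y ≡ x) → ∀ y → below x y ≡ (key y <ᵇ key x)
  below-by-key {x} unique y with <-cmp (key y) (key x)
  ... | tri< ky<kx _ _ = trans (<ᵇ-true (code-< ky<kx)) (sym (<ᵇ-true ky<kx))
  ... | tri≈ _ ky≡kx _ rewrite unique ky≡kx = trans (x∉below-x x) (sym (<ᵇ-false (≤-refl {key x})))
  ... | tri> _ _ kx<ky = trans (<ᵇ-false (<⇒≤ (code-< kx<ky))) (sym (<ᵇ-false (<⇒≤ kx<ky)))

module _ {n} {G : Graph n} {P : VSet n} {joins : TwoDisjointCrossEdges G P} (shape : TwoCliquesJoinedBy G P joins) where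
  open TwoDisjointCrossEdges joins
  open TwoCliquesJoinedBy shape

  private
    p₁≢q : ∀ {q} → P q ≡ false → p₁ ≢ q
    p₁≢q q∉P = ≢-sym (∉≢∈ {S = P} q∉P p₁∈N)

    p₂≢q : ∀ {q} → P q ≡ false → p₂ ≢ q
    p₂≢q q∉P = ≢-sym (∉≢∈ {S = P} q∉P p₂∈N)

    -- Listing p₁, p₂, the rest of P, q₁, q₂, the rest of ∁ P in this order puts P on the positions
    -- below |P| and the two crossing edges at 0–|P| and 1–(|P|+1), as in B_n^+.
    key : Fin n → ℕ
    key y = if P y then (if y == p₁ then 0 else if y == p₂ then 1 else 2)
                   else (if y == q₁ then 3 else if y == q₂ then 4 else 5)

    data Place (y : Fin n) : ℕ → Set where
      at-p₁ : y ≡ p₁ → Place y 0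
      at-p₂ : y ≡ p₂ → Place y 1
      in-P  : P y ≡ true → y ≢ p₁ → y ≢ p₂ → Place y 2
      at-q₁ : y ≡ q₁ → Place y 3
      at-q₂ : y ≡ q₂ → Place y 4
      off-P : P y ≡ false → y ≢ q₁ → y ≢ q₂ → Place y 5

    place : ∀ y → Place y (key y)
    place y with P y in y∈P | y == p₁ in y==p₁ | y == p₂ in y==p₂ | y == q₁ in y==q₁ | y == q₂ in y==q₂
    ... | true  | true  | _     | _     | _     = at-p₁ (==⇒≡ {x = y} y==p₁)
    ... | true  | false | true  | _     | _     = at-p₂ (==⇒≡ {x = y} y==p₂)
    ... | true  | false | false | _     | _     = in-P y∈P (==-false⇒≢ y==p₁) (==-false⇒≢ y==p₂)
    ... | false | _     | _     | true  | _     = at-q₁ (==⇒≡ {x = y} y==q₁)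
    ... | false | _     | _     | false | true  = at-q₂ (==⇒≡ {x = y} y==q₂)
    ... | false | _     | _     | false | false = off-P y∈P (==-false⇒≢ y==q₁) (==-false⇒≢ y==q₂)

    open Ranking key

    key-p₁ : key p₁ ≡ 0
    key-p₁ rewrite p₁∈N | ==-refl p₁ = refl

    key-p₂ : key p₂ ≡ 1
    key-p₂ rewrite p₂∈N | ==-≢ (p₁≢p₂ ∘ sym) | ==-refl p₂ = refl

    key-q₁ : key q₁ ≡ 3
    key-q₁ rewrite q₁∉N | ==-refl q₁ = refl

    key-q₂ : key q₂ ≡ 4
    key-q₂ rewrite q₂∉N | ==-≢ (q₁≢q₂ ∘ sym) | ==-refl q₂ = refl

    only-p₁ : ∀ {y} → Place y 0 → y ≡ p₁
    only-p₁ (at-p₁ y≡p₁) = y≡p₁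

    only-p₂ : ∀ {y} → Place y 1 → y ≡ p₂
    only-p₂ (at-p₂ y≡p₂) = y≡p₂

    only-q₁ : ∀ {y} → Place y 3 → y ≡ q₁
    only-q₁ (at-q₁ y≡q₁) = y≡q₁

    only-q₂ : ∀ {y} → Place y 4 → y ≡ q₂
    only-q₂ (at-q₂ y≡q₂) = y≡q₂

    below-by-place : ∀ {x k} → key x ≡ k → (∀ {y} → Place y k → y ≡ x) → ∀ y → below x y ≡ (key y <ᵇ k)
    below-by-place {x} refl only = below-by-key (λ {y} ky≡kx → only (subst (Place y) ky≡kx (place y)))

    P⇒≤2 : ∀ {y k} → Place y k → P y ≡ true → k ≤ 2
    P⇒≤2 (at-p₁ _)     _   = z≤n
    P⇒≤2 (at-p₂ _)     _   = s≤s z≤n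
    P⇒≤2 (in-P _ _ _)  _   = ≤-refl
    P⇒≤2 (at-q₁ refl)  y∈P with () ← trans (sym y∈P) q₁∉N
    P⇒≤2 (at-q₂ refl)  y∈P with () ← trans (sym y∈P) q₂∉N
    P⇒≤2 (off-P y∉P _ _) y∈P with () ← trans (sym y∈P) y∉P

    ≤2⇒P : ∀ {y k} → Place y k → k ≤ 2 → P y ≡ true
    ≤2⇒P (at-p₁ refl)   _ = p₁∈N
    ≤2⇒P (at-p₂ refl)   _ = p₂∈N
    ≤2⇒P (in-P y∈P _ _) _ = y∈P
    ≤2⇒P (at-q₁ _)      (s≤s (s≤s ()))
    ≤2⇒P (at-q₂ _)      (s≤s (s≤s ()))
    ≤2⇒P (off-P _ _ _)  (s≤s (s≤s ()))

    ∉P⇒3≤ : ∀ {y k} → Place y k → P y ≡ false → 3 ≤ k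
    ∉P⇒3≤ (at-p₁ refl) y∉P with () ← trans (sym p₁∈N) y∉P
    ∉P⇒3≤ (at-p₂ refl) y∉P with () ← trans (sym p₂∈N) y∉P
    ∉P⇒3≤ (in-P y∈P _ _) y∉P with () ← trans (sym y∈P) y∉P
    ∉P⇒3≤ (at-q₁ _) _ = ≤-refl
    ∉P⇒3≤ (at-q₂ _) _ = n≤1+n 3
    ∉P⇒3≤ (off-P _ _ _) _ = ≤-trans (n≤1+n 3) (n≤1+n 4)

    <1⇔p₁ : ∀ {y k} → Place y k → (k <ᵇ 1) ≡ (y == p₁)
    <1⇔p₁ (at-p₁ refl)         = sym (==-refl p₁)
    <1⇔p₁ (at-p₂ refl)         = sym (==-≢ (p₁≢p₂ ∘ sym))
    <1⇔p₁ (in-P _ y≢p₁ _)      = sym (==-≢ y≢p₁)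
    <1⇔p₁ (at-q₁ refl)         = sym (==-≢ (p₁≢q q₁∉N ∘ sym))
    <1⇔p₁ (at-q₂ refl)         = sym (==-≢ (p₁≢q q₂∉N ∘ sym))
    <1⇔p₁ (off-P y∉P _ _)      = sym (==-≢ (p₁≢q y∉P ∘ sym))

    <3⇔P : ∀ {y k} → Place y k → (k <ᵇ 3) ≡ P y
    <3⇔P (at-p₁ refl)    = sym p₁∈N
    <3⇔P (at-p₂ refl)    = sym p₂∈N
    <3⇔P (in-P y∈P _ _)  = sym y∈P
    <3⇔P (at-q₁ refl)    = sym q₁∉N
    <3⇔P (at-q₂ refl)    = sym q₂∉N
    <3⇔P (off-P y∉P _ _) = sym y∉P

    <4⇔P∪q₁ : ∀ {y k} → Place y k → b2n (k <ᵇ 4) ≡ b2n (P y) + b2n (y == q₁)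
    <4⇔P∪q₁ (at-p₁ refl)         rewrite p₁∈N | ==-≢ (p₁≢q q₁∉N) = refl
    <4⇔P∪q₁ (at-p₂ refl)         rewrite p₂∈N | ==-≢ (p₂≢q q₁∉N) = refl
    <4⇔P∪q₁ (in-P y∈P _ _)       rewrite y∈P | ==-≢ (∉≢∈ {S = P} q₁∉N y∈P ∘ sym) = refl
    <4⇔P∪q₁ (at-q₁ refl)         rewrite q₁∉N | ==-refl q₁ = refl
    <4⇔P∪q₁ (at-q₂ refl)         rewrite q₂∉N | ==-≢ (q₁≢q₂ ∘ sym) = refl
    <4⇔P∪q₁ (off-P y∉P y≢q₁ _)  rewrite y∉P | ==-≢ y≢q₁ = refl

    rank-p₁ : rank p₁ ≡ 0
    rank-p₁ = trans (∑-cong (λ y → cong b2n (below-by-place key-p₁ only-p₁ y))) (∑-zero n)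

    rank-p₂ : rank p₂ ≡ 1
    rank-p₂ = trans (∑-cong (λ y → cong b2n (trans (below-by-place key-p₂ only-p₂ y) (<1⇔p₁ (place y)))))
                    (size-⁅⁆ p₁)

    rank-q₁ : rank q₁ ≡ size P
    rank-q₁ = ∑-cong (λ y → cong b2n (trans (below-by-place key-q₁ only-q₁ y) (<3⇔P (place y))))

    rank-q₂ : rank q₂ ≡ suc (size P)
    rank-q₂ = begin
      rank q₂                 ≡⟨ size-⊍ {A = P} {B = ⁅ q₁ ⁆} below-q₂≐P⊍q₁ ⟩
      size P + size ⁅ q₁ ⁆    ≡⟨ cong (size P +_) (size-⁅⁆ q₁) ⟩
      size P + 1              ≡⟨ +-comm (size P) 1 ⟩
      suc (size P)            ∎
      where
      open ≡-Reasoning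
      below-q₂≐P⊍q₁ : below q₂ ≐ P ⊍ ⁅ q₁ ⁆
      below-q₂≐P⊍q₁ y = trans (cong b2n (below-by-place key-q₂ only-q₂ y)) (<4⇔P∪q₁ (place y))

    rank<ᵇsize : ∀ x → (rank x <ᵇ size P) ≡ P x
    rank<ᵇsize x = by-cases (P x) refl
      where
      by-cases : ∀ b → P x ≡ b → (rank x <ᵇ size P) ≡ b
      by-cases true  x∈P = <ᵇ-true (size-mono-⊂ below⊆P (x∉below-x x) x∈P)
        where
        below⊆P : below x ⊆ P
        below⊆P {y} y<x = ≤2⇒P (place y) (≤-trans (code-<⇒key-≤ (<ᵇ-true⇒< y<x)) (P⇒≤2 (place x) x∈P))
      by-cases false x∉P = <ᵇ-false (size-mono-⊆ P⊆below)
        where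
        P⊆below : P ⊆ below x
        P⊆below {y} y∈P = <ᵇ-true (code-< (≤-trans (s≤s (P⇒≤2 (place y) y∈P)) (∉P⇒3≤ (place x) x∉P)))

    rank≡ᵇ : ∀ x {y c} → rank y ≡ c → (rank x ≡ᵇ c) ≡ (x == y)
    rank≡ᵇ x {y} refl = rank-≡ᵇ x y

  connects : Fin n → Fin n → Bool
  connects x y = ((x == p₁) ∧ (y == q₁)) ∨ ((x == p₂) ∧ (y == q₂))

  shapeAdj : Fin n → Fin n → Bool
  shapeAdj x y = not (x == y) ∧ (sameB (P x) (P y) ∨ (connects x y ∨ connects y x))

  private
    badj-rank : ∀ x y → badj (size P) (rank x) (rank y) ≡ shapeAdj x y
    badj-rank x y rewrite rank-≡ᵇ x y | rank<ᵇsize x | rank<ᵇsize y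
                        | rank≡ᵇ x rank-p₁ | rank≡ᵇ y rank-p₁ | rank≡ᵇ x rank-p₂ | rank≡ᵇ y rank-p₂
                        | rank≡ᵇ x rank-q₁ | rank≡ᵇ y rank-q₁ | rank≡ᵇ x rank-q₂ | rank≡ᵇ y rank-q₂ = refl

    connects-∉ : ∀ {x} y → P x ≡ false → connects x y ≡ false
    connects-∉ {x} y x∉P rewrite ==-≢ (p₁≢q x∉P ∘ sym) | ==-≢ (p₂≢q x∉P ∘ sym) = refl

    pair-off : ∀ {x y p q} → adj G x y ≡ false → adj G p q ≡ true → ((x == p) ∧ (y == q)) ≡ false
    pair-off {x} {y} {p} {q} xy pq with x == p in x==p | y == q in y==q
    ... | false | _     = refl
    ... | true  | false = refl
    ... | true  | true with refl ← ==⇒≡ {x = x} {p} x==p | refl ← ==⇒≡ {x = y} {q} y==q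
                       with () ← trans (sym xy) pq

    adj-across : ∀ {x y} → P x ≡ true → P y ≡ false → adj G x y ≡ connects x y
    adj-across {x} {y} x∈P y∉P with adj G x y in xy
    ... | false = sym (cong₂ _∨_ (pair-off xy p₁q₁) (pair-off xy p₂q₂))
    ... | true with onlyCross x∈P y∉P xy
    ...   | inj₁ (refl , refl) rewrite ==-refl p₁ | ==-refl q₁ = refl
    ...   | inj₂ (refl , refl) rewrite ==-refl p₂ | ==-refl q₂ | ==-≢ (p₁≢p₂ ∘ sym) = refl

    adj-shape : ∀ x y → adj G x y ≡ shapeAdj x y
    adj-shape x y with x Finₚ.≟ y
    ... | yes refl = adj-irrefl G x
    ... | no x≢y with P x in x∈P | P y in y∈P
    ...   | true  | true  = clique (trans x∈P (sym y∈P)) x≢y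
    ...   | false | false = clique (trans x∈P (sym y∈P)) x≢y
    ...   | true  | false rewrite connects-∉ x y∈P = trans (adj-across x∈P y∈P) (sym (∨-identityʳ _))
    ...   | false | true  rewrite connects-∉ y x∈P = trans (adj-sym G x y) (adj-across y∈P x∈P)

  ≅B+ : size P ≡ n / 2 → G ≅ B+ n
  ≅B+ size≡ = vertexAt↔ , λ i j → begin
    adj G (vertexAt i) (vertexAt j)                          ≡⟨ adj-shape (vertexAt i) (vertexAt j) ⟩
    shapeAdj (vertexAt i) (vertexAt j)                       ≡⟨ sym (badj-rank (vertexAt i) (vertexAt j)) ⟩
    badj (size P) (rank (vertexAt i)) (rank (vertexAt j))    ≡⟨ cong₂ (badj (size P)) (sym (toℕ≡rank-vertexAt i)) (sym (toℕ≡rank-vertexAt j)) ⟩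
    badj (size P) (toℕ i) (toℕ j)                            ≡⟨ cong (λ k → badj k (toℕ i) (toℕ j)) size≡ ⟩
    badj (n / 2) (toℕ i) (toℕ j)                             ∎
    where open ≡-Reasoning

sameB-refl : ∀ b → sameB b b ≡ true
sameB-refl true  = refl
sameB-refl false = refl

badj-same-side : ∀ k a b → a ≢ b → (a <ᵇ k) ≡ (b <ᵇ k) → badj k a b ≡ true
badj-same-side k a b a≢b same rewrite ≡ᵇ-false a≢b | same | sameB-refl (b <ᵇ k) = refl

badj-0-k : ∀ k → 1 ≤ k → badj k 0 k ≡ true
badj-0-k (suc k) _ rewrite ≡ᵇ-true {k} refl | <ᵇ-false (≤-refl {k}) = refl

badj-1-1+k : ∀ k → 2 ≤ k → badj k 1 (suc k) ≡ true
badj-1-1+k k 2≤k rewrite ≡ᵇ-false {1} {suc k} (<⇒≢ (s≤s (≤-trans (s≤s z≤n) 2≤k)))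
                        | <ᵇ-true {1} {k} 2≤k | <ᵇ-false {suc k} {k} (n≤1+n k) | ≡ᵇ-true {k} refl = refl

∨-∧-true : ∀ x y u v → ((x ∧ y) ∨ (u ∧ v)) ∨ false ≡ true → (x ≡ true × y ≡ true) ⊎ (u ≡ true × v ≡ true)
∨-∧-true true  true  _     _     _  = inj₁ (refl , refl)
∨-∧-true true  false true  true  _  = inj₂ (refl , refl)
∨-∧-true false _     true  true  _  = inj₂ (refl , refl)
∨-∧-true true  false true  false ()
∨-∧-true true  false false _     ()
∨-∧-true false _     true  false ()
∨-∧-true false _     false _     ()

badj-across : ∀ k {a b} → 2 ≤ k → a < k → k ≤ b → badj k a b ≡ true → (a ≡ 0 × b ≡ k) ⊎ (a ≡ 1 × b ≡ suc k)
badj-across k {a} {b} 2≤k a<k k≤b ab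
  rewrite ≡ᵇ-false (<⇒≢ (≤-trans a<k k≤b)) | <ᵇ-true a<k | <ᵇ-false k≤b
        | ≡ᵇ-false {b} {0} (≢-sym (<⇒≢ (≤-trans (≤-trans (s≤s z≤n) 2≤k) k≤b)))
        | ≡ᵇ-false {b} {1} (≢-sym (<⇒≢ (≤-trans 2≤k k≤b)))
  with ∨-∧-true (a ≡ᵇ 0) (b ≡ᵇ k) (a ≡ᵇ 1) (b ≡ᵇ suc k) ab
... | inj₁ (a≡0 , b≡k)   = inj₁ (≡ᵇ-true⇒≡ a≡0 , ≡ᵇ-true⇒≡ b≡k)
... | inj₂ (a≡1 , b≡1+k) = inj₂ (≡ᵇ-true⇒≡ a≡1 , ≡ᵇ-true⇒≡ b≡1+k)

module _ (n : ℕ) (4≤n : 4 ≤ n) where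
  private
    k : ℕ
    k = n / 2

    2≤k : 2 ≤ k
    2≤k = /-monoˡ-≤ 2 4≤n

    2+k≤n : 2 + k ≤ n
    2+k≤n with even-or-odd n
    ... | inj₁ n≡2k   = ≤-trans (+-monoˡ-≤ k 2≤k) (≤-reflexive (sym (trans n≡2k (cong (k +_) (+-identityʳ k)))))
    ... | inj₂ n≡1+2k = ≤-trans (+-monoˡ-≤ k 2≤k) (≤-trans (n≤1+n _) (≤-reflexive (sym (trans n≡1+2k (cong (λ m → suc (k + m)) (+-identityʳ k))))))

    k<n : k < n
    k<n = ≤-trans (n≤1+n (suc k)) 2+k≤n

    2≤n : 2 ≤ n
    2≤n = ≤-trans 2≤k (<⇒≤ k<n)

    left : VSet n
    left i = toℕ i <ᵇ k

    0<n : 0 < n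
    0<n = ≤-trans (s≤s z≤n) 2≤n

    p₁ p₂ q₁ q₂ : Fin n
    p₁ = fromℕ< 0<n
    p₂ = fromℕ< 2≤n
    q₁ = fromℕ< k<n
    q₂ = fromℕ< 2+k≤n

    toℕ-p₁ : toℕ p₁ ≡ 0
    toℕ-p₁ = Finₚ.toℕ-fromℕ< 0<n
    toℕ-p₂ : toℕ p₂ ≡ 1
    toℕ-p₂ = Finₚ.toℕ-fromℕ< 2≤n
    toℕ-q₁ : toℕ q₁ ≡ k
    toℕ-q₁ = Finₚ.toℕ-fromℕ< k<n
    toℕ-q₂ : toℕ q₂ ≡ suc k
    toℕ-q₂ = Finₚ.toℕ-fromℕ< 2+k≤n

    B+-crossEdges : TwoDisjointCrossEdges (B+ n) left
    B+-crossEdges = crossEdges {p₁ = p₁} {p₂} {q₁} {q₂}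
      (trans (cong (_<ᵇ k) toℕ-p₁) (<ᵇ-true (≤-trans (s≤s z≤n) 2≤k)))
      (trans (cong (_<ᵇ k) toℕ-p₂) (<ᵇ-true 2≤k))
      (trans (cong (_<ᵇ k) toℕ-q₁) (<ᵇ-false (≤-refl {k})))
      (trans (cong (_<ᵇ k) toℕ-q₂) (<ᵇ-false (n≤1+n k)))
      (λ p₁≡p₂ → case trans (sym toℕ-p₁) (trans (cong toℕ p₁≡p₂) toℕ-p₂) of λ ())
      (λ q₁≡q₂ → <-irrefl (trans (sym toℕ-q₁) (trans (cong toℕ q₁≡q₂) toℕ-q₂)) ≤-refl)
      (trans (cong₂ (badj k) toℕ-p₁ toℕ-q₁) (badj-0-k k (≤-trans (s≤s z≤n) 2≤k)))
      (trans (cong₂ (badj k) toℕ-p₂ toℕ-q₂) (badj-1-1+k k 2≤k))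

    B+-shape : TwoCliquesJoinedBy (B+ n) left B+-crossEdges
    B+-shape = record
      { clique    = λ {x} {y} same x≢y → badj-same-side k (toℕ x) (toℕ y) (x≢y ∘ Finₚ.toℕ-injective) same
      ; onlyCross = λ {x} {y} x∈left y∉left xy → onlyCross x∈left y∉left xy
      }
      where
      at : ∀ {x y a} → toℕ y ≡ a → toℕ x ≡ a → x ≡ y
      at toℕy≡a toℕx≡a = Finₚ.toℕ-injective (trans toℕx≡a (sym toℕy≡a))
      onlyCross : ∀ {x y} → left x ≡ true → left y ≡ false → badj k (toℕ x) (toℕ y) ≡ true →
                  (x ≡ p₁ × y ≡ q₁) ⊎ (x ≡ p₂ × y ≡ q₂)
      onlyCross x∈left y∉left xy with badj-across k 2≤k (<ᵇ-true⇒< x∈left) (<ᵇ-false⇒≥ y∉left) xy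
      ... | inj₁ (x≡0 , y≡k)   = inj₁ (at toℕ-p₁ x≡0 , at toℕ-q₁ y≡k)
      ... | inj₂ (x≡1 , y≡1+k) = inj₂ (at toℕ-p₂ x≡1 , at toℕ-q₂ y≡1+k)

  e-B+ : e (B+ n) ≡ bound n
  e-B+ = +-cancelʳ-≡ ⌊ n ²/4⌋ _ _ (begin
    e (B+ n) + ⌊ n ²/4⌋                           ≡⟨ cong (e (B+ n) +_) (sym quarter) ⟩
    e (B+ n) + (e (complement (B+ n)) + 2)         ≡⟨ sym (+-assoc (e (B+ n)) _ 2) ⟩
    e (B+ n) + e (complement (B+ n)) + 2           ≡⟨ e+eᶜ+2≡bound+⌊²/4⌋ (B+ n) (≤-trans (s≤s z≤n) 4≤n) ⟩
    bound n + ⌊ n ²/4⌋                             ∎)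
    where
    open ≡-Reasoning
    size-left : size left ≡ k
    size-left = size-below k (<⇒≤ k<n)
    sizes : size left + size (∁ left) ≡ n
    sizes = size-S+size-∁S left
    quarter : e (complement (B+ n)) + 2 ≡ ⌊ n ²/4⌋
    quarter = begin
      e (complement (B+ n)) + 2        ≡⟨ eᶜ+2≡size*size B+-shape ⟩
      size left * size (∁ left)        ≡⟨ half*rest≡⌊²/4⌋ (size left) (size (∁ left))
                                            (trans size-left (cong (_/ 2) (sym sizes))) ⟩
      ⌊ size left + size (∁ left) ²/4⌋ ≡⟨ cong ⌊_²/4⌋ sizes ⟩
      ⌊ n ²/4⌋                          ∎

ComplementBound : ∀ {n} → Graph n → Set
ComplementBound {n} G = e (complement G) + 2 ≤ ⌊ n ²/4⌋ × (e (complement G) + 2 ≡ ⌊ n ²/4⌋ → G ≅ B+ n)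

strictly : ∀ {n} {G : Graph n} → e (complement G) + 3 ≤ ⌊ n ²/4⌋ → ComplementBound G
strictly {n} {G} E+3≤ = ≤-trans (n≤1+n _) E+2<Q , λ E+2≡Q → ⊥-elim (<-irrefl E+2≡Q E+2<Q)
  where
  E+2<Q : e (complement G) + 2 < ⌊ n ²/4⌋
  E+2<Q = subst (_≤ ⌊ n ²/4⌋) (+-suc (e (complement G)) 2) E+3≤

module _ {n} (G : Graph n) (10≤n : 10 ≤ n) where
  private
    Gᶜ : Graph n
    Gᶜ = complement G
    E : ℕ
    E = e Gᶜ
  open Counting Gᶜ

  triangle-case : Is4-2 G → Triangle full → E + 3 ≤ ⌊ n ²/4⌋
  triangle-case is4-2 (triangle {x} {y} {z} _ _ _ xy xz yz) =
    subst (λ m → E + 3 ≤ ⌊ m ²/4⌋) (sym n≡3+s) (triangle-case-bound E s 7≤s 4E≤)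
    where
    S₃ : VSet n
    S₃ = full ─ x ─ y ─ z
    s : ℕ
    s = size S₃
    n≡3+s : n ≡ 3 + s
    n≡3+s = trans (sym (size-full n)) (size-─-─-─ {S = full} refl refl refl (≢-sym (adj⇒≢ xy)) (≢-sym (adj⇒≢ xz)) (≢-sym (adj⇒≢ yz)))
    7≤s : 7 ≤ s
    7≤s = +-cancelˡ-≤ 3 7 s (subst (10 ≤_) n≡3+s 10≤n)
    mantel₃ : 2 * degSum S₃ ≤ s * s
    mantel₃ with mantel-or-triangle (Is4-2⇒OneNeighbourPerTriangle {G = G} is4-2) S₃
    ... | inj₁ bound₃    = bound₃
    ... | inj₂ (s≡3 , _) = ⊥-elim (<-irrefl (sym s≡3) (≤-trans (s≤s (s≤s (s≤s (s≤s z≤n)))) 7≤s))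
    4E≤ : 4 * E ≤ s * s + 4 * s + 12
    4E≤ = begin
      4 * E                              ≡⟨ *-assoc 2 2 E ⟩
      2 * (2 * E)                        ≡⟨ cong (2 *_) (sym (degSum-full≡2*e Gᶜ)) ⟩
      2 * degSum full                    ≤⟨ *-monoʳ-≤ 2 (removeTriangle full refl refl refl xy xz yz
                                              (Is4-2⇒OneNeighbourPerTriangle {G = G} is4-2 xy xz yz)) ⟩
      2 * (degSum S₃ + 2 * s + 6)        ≡⟨ expand (degSum S₃) s ⟩
      2 * degSum S₃ + (4 * s + 12)       ≤⟨ +-monoˡ-≤ (4 * s + 12) mantel₃ ⟩
      s * s + (4 * s + 12)               ≡⟨ sym (+-assoc (s * s) (4 * s) 12) ⟩
      s * s + 4 * s + 12                 ∎
      where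
      open ≤-Reasoning
      expand : ∀ d s → 2 * (d + 2 * s + 6) ≡ 2 * d + (4 * s + 12)
      expand = solve-∀

  module MaxDegree (noTriangle : TriangleFree full) (v : Fin n) (maximal : ∀ u → deg full u ≤ deg full v) where
    private
      module K = Counting G

    N W : VSet n
    N = adj Gᶜ v
    W = ∁ N

    Δ w m : ℕ
    Δ = size N
    w = size W
    m = K.edgesBetween W N

    Δ+w≡n : Δ + w ≡ n
    Δ+w≡n = size-S+size-∁S N

    10≤Δ+w : 10 ≤ Δ + w
    10≤Δ+w = subst (10 ≤_) (sym Δ+w≡n) 10≤n

    ⌊Δ+w²/4⌋≡ : ⌊ Δ + w ²/4⌋ ≡ ⌊ n ²/4⌋
    ⌊Δ+w²/4⌋≡ = cong ⌊_²/4⌋ Δ+w≡n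

    W∉N : ∀ {u} → W u ≡ true → N u ≡ false
    W∉N = ∁⇒∉ {S = N}

    N-independent : ∀ {x y} → N x ≡ true → N y ≡ true → adj Gᶜ x y ≡ false
    N-independent {x} {y} x∈N y∈N with adj Gᶜ x y in xy
    ... | false = refl
    ... | true  = ⊥-elim (noTriangle (triangle refl refl refl x∈N y∈N xy))

    degSum-N≡0 : degSum N ≡ 0
    degSum-N≡0 with zero-or-Edge N
    ... | inj₁ degSum≡0 = degSum≡0
    ... | inj₂ (edge x∈N y∈N xy) with () ← trans (sym xy) (N-independent x∈N y∈N)

    2E≡ : 2 * E ≡ 2 * edgesBetween W N + degSum W
    2E≡ = begin
      2 * E                                                ≡⟨ sym (degSum-full≡2*e Gᶜ) ⟩
      degSum full                                          ≡⟨ degSum-⊍ {full} {N} {W} (full≐S⊍∁S N) ⟩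
      degSum N + 2 * edgesBetween N W + degSum W           ≡⟨ cong₂ (λ a b → a + 2 * b + degSum W) degSum-N≡0 (edgesBetween-comm N W) ⟩
      2 * edgesBetween W N + degSum W                      ∎
      where open ≡-Reasoning

    C+m≡Δw : edgesBetween W N + m ≡ Δ * w
    C+m≡Δw = edgesBetweenᶜ+edgesBetween≡ G W N (λ _ → W∉N)

    degᶜ+deg≡Δ : ∀ {u} → W u ≡ true → deg N u + K.deg N u ≡ Δ
    degᶜ+deg≡Δ u∈W = degᶜ+deg≡size G N _ (W∉N u∈W)

    deg-W≤deg-N : ∀ {u} → W u ≡ true → deg W u ≤ K.deg N u
    deg-W≤deg-N {u} u∈W = +-cancelˡ-≤ (deg N u) _ _ (begin
      deg N u + deg W u       ≡⟨ sym (deg-⊍ {full} {N} {W} (full≐S⊍∁S N) u) ⟩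
      deg full u              ≤⟨ maximal u ⟩
      deg full v              ≡⟨ ∑-cong (λ x → *-identityˡ _) ⟩
      Δ                       ≡⟨ sym (degᶜ+deg≡Δ u∈W) ⟩
      deg N u + K.deg N u     ∎)
      where open ≤-Reasoning

    W-degree : Fin n → ℕ
    W-degree u = b2n (W u) * K.deg N u

    W-degree-∈ : ∀ {u} → W u ≡ true → W-degree u ≡ K.deg N u
    W-degree-∈ u∈W rewrite u∈W = +-identityʳ _

    degSum-W≤m : degSum W ≤ m
    degSum-W≤m = ∑-mono-≤ pointwise
      where
      pointwise : ∀ u → b2n (W u) * deg W u ≤ W-degree u
      pointwise u with W u in u∈W
      ... | false = z≤n
      ... | true  = +-monoˡ-≤ 0 (deg-W≤deg-N u∈W)

    edge-case : Edge W → 2 * E + Δ ≤ 2 * (Δ * w)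
    edge-case (edge {a} {b} a∈W b∈W ab) = begin
      2 * E + Δ                                   ≡⟨ cong (_+ Δ) 2E≡ ⟩
      2 * edgesBetween W N + degSum W + Δ         ≤⟨ +-mono-≤ (+-monoʳ-≤ (2 * edgesBetween W N) degSum-W≤m) Δ≤m ⟩
      2 * edgesBetween W N + m + m                ≡⟨ regroup (edgesBetween W N) m ⟩
      2 * (edgesBetween W N + m)                  ≡⟨ cong (2 *_) C+m≡Δw ⟩
      2 * (Δ * w)                                 ∎
      where
      open ≤-Reasoning
      regroup : ∀ c m → 2 * c + m + m ≡ 2 * (c + m)
      regroup = solve-∀
      sharesNone : ∀ x → N x ≡ true → b2n (adj Gᶜ a x) + b2n (adj Gᶜ b x) ≤ 1
      sharesNone x x∈N with adj Gᶜ a x in ax | adj Gᶜ b x in bx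
      ... | true  | true  = ⊥-elim (noTriangle (triangle refl refl refl ab ax bx))
      ... | true  | false = ≤-refl
      ... | false | true  = ≤-refl
      ... | false | false = z≤n
      degsᶜ≤Δ : deg N a + deg N b ≤ Δ
      degsᶜ≤Δ = subst (_≤ Δ) (sym (deg-+-deg N a b)) (∑-in-≤-size N _ sharesNone)
      Δ≤degs : Δ ≤ K.deg N a + K.deg N b
      Δ≤degs = +-cancelˡ-≤ Δ _ _ (begin
        Δ + Δ                                           ≡⟨ sym (cong₂ _+_ (degᶜ+deg≡Δ a∈W) (degᶜ+deg≡Δ b∈W)) ⟩
        deg N a + K.deg N a + (deg N b + K.deg N b)     ≡⟨ interchange (deg N a) (K.deg N a) (deg N b) (K.deg N b) ⟩
        deg N a + deg N b + (K.deg N a + K.deg N b)     ≤⟨ +-monoˡ-≤ _ degsᶜ≤Δ ⟩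
        Δ + (K.deg N a + K.deg N b)                     ∎)
        where
        interchange : ∀ p q r s → p + q + (r + s) ≡ p + r + (q + s)
        interchange = solve-∀
      Δ≤m : Δ ≤ m
      Δ≤m = ≤-trans Δ≤degs (subst (_≤ m) (cong₂ _+_ (W-degree-∈ a∈W) (W-degree-∈ b∈W))
                                  (∑-≥-pair W-degree (adj⇒≢ ab)))

    module W-independent (degSum-W≡0 : degSum W ≡ 0) where

      E+m≡Δw : E + m ≡ Δ * w
      E+m≡Δw = trans (cong (_+ m) E≡C) C+m≡Δw
        where
        E≡C : E ≡ edgesBetween W N
        E≡C = *-cancelˡ-≡ _ _ 2 (trans 2E≡ (trans (cong (2 * edgesBetween W N +_) degSum-W≡0) (+-identityʳ _)))

      clique : ∀ {x y} → N x ≡ N y → x ≢ y → adj G x y ≡ true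
      clique {x} {y} same x≢y with adj G x y in xy
      ... | true  = refl
      ... | false = by-cases (N x) refl
        where
        xyᶜ : adj Gᶜ x y ≡ true
        xyᶜ = ¬adj⇒adjᶜ {G = G} x≢y xy
        by-cases : ∀ b → N x ≡ b → false ≡ true
        by-cases true  x∈N with () ← trans (sym (N-independent x∈N (trans (sym same) x∈N))) xyᶜ
        by-cases false x∉N with () ← <-irrefl (sym degSum-W≡0)
          (Edge⇒degSum-positive (edge (∉⇒∁ {S = N} x∉N) (∉⇒∁ {S = N} (trans (sym same) x∉N)) xyᶜ))

      module _ (joins : TwoDisjointCrossEdges G N) where
        open TwoDisjointCrossEdges joins

        private
          neighbour⇒1≤ : ∀ {u x} → N x ≡ true → adj G u x ≡ true → 1 ≤ K.deg N u
          neighbour⇒1≤ {u} {x} x∈N ux = subst (_≤ K.deg N u) (cong₂ (λ a b → b2n a * b2n b) x∈N ux) (∑-≥-term _ x)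

          neighbours⇒2≤ : ∀ {u x y} → x ≢ y → N x ≡ true → adj G u x ≡ true → N y ≡ true → adj G u y ≡ true → 2 ≤ K.deg N u
          neighbours⇒2≤ {u} x≢y x∈N ux y∈N uy =
            subst (_≤ K.deg N u) (cong₂ _+_ (cong₂ (λ a b → b2n a * b2n b) x∈N ux) (cong₂ (λ a b → b2n a * b2n b) y∈N uy))
                  (∑-≥-pair _ x≢y)

          q₁-degree : 1 ≤ W-degree q₁
          q₁-degree = subst (1 ≤_) (sym (W-degree-∈ (∉⇒∁ {S = N} q₁∉N))) (neighbour⇒1≤ p₁∈N (trans (adj-sym G _ _) p₁q₁))

          q₂-degree : 1 ≤ W-degree q₂
          q₂-degree = subst (1 ≤_) (sym (W-degree-∈ (∉⇒∁ {S = N} q₂∉N))) (neighbour⇒1≤ p₂∈N (trans (adj-sym G _ _) p₂q₂))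

        3≰m : m ≡ 2 → 3 ≤ m → ⊥
        3≰m m≡2 3≤m = <-irrefl refl (≤-trans 3≤m (≤-reflexive m≡2))

        2≤m : 2 ≤ m
        2≤m = ≤-trans (+-mono-≤ q₁-degree q₂-degree) (∑-≥-pair W-degree q₁≢q₂)

        onlyCross : m ≡ 2 → ∀ {x y} → N x ≡ true → N y ≡ false → adj G x y ≡ true → (x ≡ p₁ × y ≡ q₁) ⊎ (x ≡ p₂ × y ≡ q₂)
        onlyCross m≡2 {x} {y} x∈N y∉N xy with y Finₚ.≟ q₁ | y Finₚ.≟ q₂
        ... | yes refl | _ with x Finₚ.≟ p₁
        ...   | yes x≡p₁ = inj₁ (x≡p₁ , refl)
        ...   | no x≢p₁  = ⊥-elim (3≰m m≡2 (≤-trans (+-mono-≤ (subst (2 ≤_) (sym (W-degree-∈ y∈W))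
                              (neighbours⇒2≤ x≢p₁ x∈N yx p₁∈N (trans (adj-sym G _ _) p₁q₁))) q₂-degree)
                              (∑-≥-pair W-degree q₁≢q₂)))
          where
          y∈W : W y ≡ true
          y∈W = ∉⇒∁ {S = N} y∉N
          yx : adj G y x ≡ true
          yx = trans (adj-sym G _ _) xy
        onlyCross m≡2 {x} {y} x∈N y∉N xy | no y≢q₁ | yes refl with x Finₚ.≟ p₂
        ...   | yes x≡p₂ = inj₂ (x≡p₂ , refl)
        ...   | no x≢p₂  = ⊥-elim (3≰m m≡2 (≤-trans (+-mono-≤ q₁-degree (subst (2 ≤_) (sym (W-degree-∈ y∈W))
                              (neighbours⇒2≤ x≢p₂ x∈N yx p₂∈N (trans (adj-sym G _ _) p₂q₂))))
                              (∑-≥-pair W-degree q₁≢q₂)))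
          where
          y∈W : W y ≡ true
          y∈W = ∉⇒∁ {S = N} y∉N
          yx : adj G y x ≡ true
          yx = trans (adj-sym G _ _) xy
        onlyCross m≡2 {x} {y} x∈N y∉N xy | no y≢q₁ | no y≢q₂ =
          ⊥-elim (3≰m m≡2 (≤-trans (+-mono-≤ (+-mono-≤ q₁-degree q₂-degree) y-degree)
                               (∑-≥-triple W-degree q₁≢q₂ (y≢q₁ ∘ sym) (y≢q₂ ∘ sym))))
          where
          y∈W : W y ≡ true
          y∈W = ∉⇒∁ {S = N} y∉N
          y-degree : 1 ≤ W-degree y
          y-degree = subst (1 ≤_) (sym (W-degree-∈ y∈W)) (neighbour⇒1≤ x∈N (trans (adj-sym G _ _) xy))

        shape : m ≡ 2 → TwoCliquesJoinedBy G N joins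
        shape m≡2 = record { clique = clique ; onlyCross = onlyCross m≡2 }

      small-side : Δ ≤ 1 ⊎ w ≤ 1 → ComplementBound G
      small-side small = strictly {G = G} (subst (E + 3 ≤_) ⌊Δ+w²/4⌋≡
        (small-side-bound E Δ w 10≤Δ+w small (≤-trans (m≤m+n E m) (≤-reflexive E+m≡Δw))))

      large-sides : TwoDisjointCrossEdges G N → ComplementBound G
      large-sides joins = ≤-trans E+2≤Δw Δw≤Q , equality
        where
        E+2≤Δw : E + 2 ≤ Δ * w
        E+2≤Δw = ≤-trans (+-monoʳ-≤ E (2≤m joins)) (≤-reflexive E+m≡Δw)
        Δw≤Q : Δ * w ≤ ⌊ n ²/4⌋
        Δw≤Q = subst (Δ * w ≤_) ⌊Δ+w²/4⌋≡ (ab≤⌊[a+b]²/4⌋ Δ w)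
        equality : E + 2 ≡ ⌊ n ²/4⌋ → G ≅ B+ n
        equality E+2≡Q = iso (ab≡⌊[a+b]²/4⌋⇒half Δ w (trans Δw≡Q (sym ⌊Δ+w²/4⌋≡)))
          where
          Δw≡Q : Δ * w ≡ ⌊ n ²/4⌋
          Δw≡Q = ≤-antisym Δw≤Q (subst (_≤ Δ * w) E+2≡Q E+2≤Δw)
          m≡2 : m ≡ 2
          m≡2 = +-cancelˡ-≡ E m 2 (trans E+m≡Δw (trans Δw≡Q (sym E+2≡Q)))
          iso : Δ ≡ (Δ + w) / 2 ⊎ w ≡ (Δ + w) / 2 → G ≅ B+ n
          iso (inj₁ Δ≡half) = ≅B+ (shape joins m≡2) (trans Δ≡half (cong (_/ 2) Δ+w≡n))
          iso (inj₂ w≡half) = ≅B+ (∁-TwoCliquesJoinedBy (shape joins m≡2)) (trans w≡half (cong (_/ 2) Δ+w≡n))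

    triangle-free-case : TwoConnected G → ComplementBound G
    triangle-free-case connected with zero-or-Edge W
    ... | inj₂ edgeW = strictly {G = G} (subst (E + 3 ≤_) ⌊Δ+w²/4⌋≡ (edge-case-bound E Δ w 10≤Δ+w (edge-case edgeW)))
    ... | inj₁ degSum-W≡0 with 2 ≤? Δ | 2 ≤? w
    ...   | yes 2≤Δ | yes 2≤w = W-independent.large-sides degSum-W≡0 (twoDisjointCrossEdges connected 2≤Δ 2≤w)
    ...   | no Δ≱2  | _       = W-independent.small-side degSum-W≡0 (inj₁ (≤-pred (≰⇒> Δ≱2)))
    ...   | yes _   | no w≱2  = W-independent.small-side degSum-W≡0 (inj₂ (≤-pred (≰⇒> w≱2)))

  complement-bound : TwoConnected G → Is4-2 G → ComplementBound G
  complement-bound connected is4-2 with triangle? full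
  ... | yes t = strictly {G = G} (triangle-case is4-2 t)
  ... | no noTriangle with argmax (fromℕ< (≤-trans (s≤s z≤n) 10≤n)) (deg full)
  ...   | v , maximal = MaxDegree.triangle-free-case noTriangle v maximal connected

theorem11 : (n : ℕ) → 10 ≤ n → (G : Graph n) → TwoConnected G → Is4-2 G →
    (bound n ≤ e G) × ((e G ≡ bound n) ⇔ (G ≅ B+ n))
theorem11 n 10≤n G connected is4-2 with complement-bound G 10≤n connected is4-2
... | E+2≤Q , equality⇒≅ = lower , mk⇔ extremal⇒≅ ≅⇒extremal
  where
  Eᶜ : ℕ
  Eᶜ = e (complement G)
  sum≡ : e G + (Eᶜ + 2) ≡ bound n + ⌊ n ²/4⌋
  sum≡ = trans (sym (+-assoc (e G) Eᶜ 2)) (e+eᶜ+2≡bound+⌊²/4⌋ G (≤-trans (s≤s z≤n) 10≤n))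
  lower : bound n ≤ e G
  lower = +-cancelʳ-≤ ⌊ n ²/4⌋ _ _ (≤-trans (≤-reflexive (sym sum≡)) (+-monoʳ-≤ (e G) E+2≤Q))
  extremal⇒≅ : e G ≡ bound n → G ≅ B+ n
  extremal⇒≅ e≡bound = equality⇒≅ (+-cancelˡ-≡ (bound n) _ _ (trans (cong (_+ (Eᶜ + 2)) (sym e≡bound)) sum≡))
  ≅⇒extremal : G ≅ B+ n → e G ≡ bound n
  ≅⇒extremal G≅B+ = trans (e-≅ {G = G} {H = B+ n} G≅B+) (e-B+ n (≤-trans (s≤s (s≤s (s≤s (s≤s z≤n)))) 10≤n))
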